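{- Let $\lambda=(\lambda_1\ge\lambda_2\ge\dots\ge\lambda_\ell>0)$ be a partition with $\ell=\ell(\lambda)$ parts and conjugate partition $\lambda'$, and let $x_1,x_2,\dots$ and $y_1,y_2,\dots$ be commutative variables. For a corner $(r,s)$ of the Young diagram $[\lambda]$ write $$\Pi_{rs}=x_r\,y_s\prod_{i=1}^{r-1}\left(1+\frac{x_i}{x_{i+1}+\dots+x_r+y_{s+1}+\dots+y_{\lambda_i}}\right)\prod_{j=1}^{s-1}\left(1+\frac{y_j}{x_{r+1}+\dots+x_{\lambda'_j}+y_{j+1}+\dots+y_s}\right).$$ Then the following rational function identities hold, where every sum over $(r,s)$ runs over all corners $(r,s)$ of $[\lambda]$: (a) $\displaystyle\sum_{(r,s)}\Pi_{rs}=\sum_{(p,q)\in[\lambda]}x_p\,y_q$; (b) $\displaystyle\sum_{(r,s)}\frac{1}{x_{r+1}+\dots+x_{\ell}+y_1+\dots+y_s}\,\Pi_{rs}=\sum_{p=1}^{\ell}x_p$; (c) $\displaystyle\sum_{(r,s)}\frac{1}{x_1+\dots+x_r+y_{s+1}+\dots+y_{\lambda_1}}\,\Pi_{rs}=\sum_{q=1}^{\lambda_1}y_q$; (d) $\displaystyle\sum_{(r,s)}\frac{1}{(x_{r+1}+\dots+x_{\ell}+y_1+\dots+y_s)(x_1+\dots+x_r+y_{s+1}+\dots+y_{\lambda_1})}\,\Pi_{rs}=1$.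
   Context: The Young diagram of $\lambda$ is $[\lambda]=\{(i,j)\in\mathbb{Z}^2: i\ge1,\ 1\le j\le\lambda_i\}$, with the first coordinate (row) increasing downwards and the second (column) increasing to the right. The conjugate partition is $\lambda'_j=|\{i:\lambda_i\ge j\}|$. A corner of $[\lambda]$ is a square $(i,j)\in[\lambda]$ with $(i+1,j)\notin[\lambda]$ and $(i,j+1)\notin[\lambda]$. Empty sums are $0$ and empty products are $1$. -}

module Defs where

open import Level using (Level; _⊔_)
open import Data.Nat as ℕ using (ℕ; zero; suc; _∸_; _≤_; _<_; _≤?_; _<?_; _≥_)
open import Data.List using (List; []; _∷_; length; filter)
open import Data.List.Relation.Unary.All using (All)
open import Data.List.Relation.Unary.Linked using (Linked)
open import Data.Product using (_×_)
open import Data.Bool using (if_then_else_)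
open import Relation.Nullary using (¬_; Dec)
open import Relation.Nullary.Decidable using (_×-dec_; ¬?; ⌊_⌋)
open import Algebra.Bundles using (CommutativeRing)

-- Fields (not in agda-stdlib): a commutative ring with 0 ≉ 1 and a
-- total inverse operation which is a two-sided inverse on nonzero
-- elements (the value of inv 0 is irrelevant).

record Field (c ℓ : Level) : Set (Level.suc (c ⊔ ℓ)) where
  field
    commutativeRing : CommutativeRing c ℓ
  open CommutativeRing commutativeRing public
  field
    inv         : Carrier → Carrier
    inv-cong    : ∀ {a b} → a ≈ b → inv a ≈ inv b
    0≉1         : ¬ (0# ≈ 1#)
    inverseʳ    : ∀ a → ¬ (a ≈ 0#) → a * inv a ≈ 1#

IsPartition : List ℕ → Set
IsPartition λs = All (1 ≤_) λs × Linked _≥_ λs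

-- 0-indexed lookup with default 0
nth : List ℕ → ℕ → ℕ
nth []       _       = 0
nth (a ∷ _)  zero    = a
nth (_ ∷ as) (suc k) = nth as k

-- λ_i (1-indexed); λ_i = 0 for i > ℓ (and, by convention, for i = 0)
part : List ℕ → ℕ → ℕ
part λs zero    = 0
part λs (suc k) = nth λs k

conj : List ℕ → ℕ → ℕ
conj λs j = length (filter (λ a → j ≤? a) λs)

InDiagram : List ℕ → ℕ → ℕ → Set
InDiagram λs i j = (1 ≤ i) × ((1 ≤ j) × (j ≤ part λs i))

inDiagram? : ∀ λs i j → Dec (InDiagram λs i j)
inDiagram? λs i j = (1 ≤? i) ×-dec ((1 ≤? j) ×-dec (j ≤? part λs i))

IsCorner : List ℕ → ℕ → ℕ → Set
IsCorner λs r s =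
  InDiagram λs r s × (¬ InDiagram λs (suc r) s × ¬ InDiagram λs r (suc s))

isCorner? : ∀ λs r s → Dec (IsCorner λs r s)
isCorner? λs r s =
  inDiagram? λs r s ×-dec (¬? (inDiagram? λs (suc r) s) ×-dec ¬? (inDiagram? λs r (suc s)))

module FieldDefs {c ℓ : Level} (F : Field c ℓ) where
  open Field F

  sumFrom : ℕ → ℕ → (ℕ → Carrier) → Carrier
  sumFrom a zero    f = 0#
  sumFrom a (suc n) f = f a + sumFrom (suc a) n f

  prodFrom : ℕ → ℕ → (ℕ → Carrier) → Carrier
  prodFrom a zero    f = 1#
  prodFrom a (suc n) f = f a * prodFrom (suc a) n f

  -- Σ_{k=a}^{b} f k   (empty, i.e. 0, when b < a)
  Σ[_⋯_] : ℕ → ℕ → (ℕ → Carrier) → Carrier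
  Σ[ a ⋯ b ] f = sumFrom a (suc b ∸ a) f

  -- Π_{k=a}^{b} f k   (empty, i.e. 1, when b < a)
  Π[_⋯_] : ℕ → ℕ → (ℕ → Carrier) → Carrier
  Π[ a ⋯ b ] f = prodFrom a (suc b ∸ a) f

  module Identities (λs : List ℕ) (x y : ℕ → Carrier) where
    ℓλ : ℕ
    ℓλ = length λs

    S : ℕ → ℕ → ℕ → ℕ → Carrier
    S a b c′ d = Σ[ a ⋯ b ] x + Σ[ c′ ⋯ d ] y

    Dx : ℕ → ℕ → ℕ → Carrier
    Dx r s i = S (suc i) r (suc s) (part λs i)

    Dy : ℕ → ℕ → ℕ → Carrier
    Dy r s j = S (suc r) (conj λs j) (suc j) s

    Π : ℕ → ℕ → Carrier
    Π r s = ((x r * y s)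
              * Π[ 1 ⋯ r ∸ 1 ] (λ i → 1# + x i * inv (Dx r s i)))
              * Π[ 1 ⋯ s ∸ 1 ] (λ j → 1# + y j * inv (Dy r s j))

    B : ℕ → ℕ → Carrier
    B r s = S (suc r) ℓλ 1 s

    C : ℕ → ℕ → Carrier
    C r s = S 1 r (suc s) (part λs 1)

    -- sum over all corners (r,s) of [λ]  (every cell lies in the box
    -- 1 ≤ r ≤ ℓ, 1 ≤ s ≤ λ_1)
    cornerSum : (ℕ → ℕ → Carrier) → Carrier
    cornerSum f = Σ[ 1 ⋯ ℓλ ] (λ r → Σ[ 1 ⋯ part λs 1 ] (λ s →
                    if ⌊ isCorner? λs r s ⌋ then f r s else 0#))

    cellSum : Carrier
    cellSum = Σ[ 1 ⋯ ℓλ ] (λ p → Σ[ 1 ⋯ part λs p ] (λ q → x p * y q))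

    ΠDefined : Set ℓ
    ΠDefined = ∀ r s → IsCorner λs r s →
      (∀ i → 1 ≤ i → i < r → ¬ (Dx r s i ≈ 0#)) ×
      (∀ j → 1 ≤ j → j < s → ¬ (Dy r s j ≈ 0#))

    BDefined : Set ℓ
    BDefined = ∀ r s → IsCorner λs r s → ¬ (B r s ≈ 0#)

    CDefined : Set ℓ
    CDefined = ∀ r s → IsCorner λs r s → ¬ (C r s ≈ 0#)

module Submission where

-- Induction on the number of rows.  Write λ = (a, ν), where ν is λ without
-- its first row, and shift x′ = (x₂, x₃, …).  The corners of λ are those of
-- ν moved one row down, plus (1, a) exactly when ν₁ < a.  A moved corner has
-- Π^λ_{r+1,s} = Π^ν_{rs} (1 + x₁/D) and C^λ_{r+1,s} = x₁ + D, where
-- D = C^ν_{rs} + β and β = y_{ν₁+1} + … + y_a; the new corner has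
-- Π^λ_{1a} = x₁ β G^ν(β), with G(t) = ∏_{j ≤ λ₁} (1 + y_j/(C̃_j + t)) and
-- C̃_j = x₁ + … + x_{λ'_j} + y_{j+1} + … + y_{λ₁}.  Identities (a)–(d) are
-- proved simultaneously with two auxiliary ones (Y = y₁ + … + y_{λ₁}):
--   (H)  Σ Π_{rs}/(C_{rs} + t) + t G(t) = Y + t,
--   (J)  Σ Π_{rs} (α + C_{rs})/(C_{rs} (C_{rs} + α + t)) + t G(α + t) = Y + t,
-- (J) being what (H) for λ becomes when ν₁ = a.

open import Defs
open import Level using (Level; _⊔_)
open import Data.Nat using (ℕ; zero; suc; _≤_; _<_; _≤?_; _∸_; z≤n; s≤s) renaming (_+_ to _+ℕ_)
import Data.Nat.Properties as ℕₚ
open import Data.List using (List; []; _∷_; length)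
import Data.List.Properties as Listₚ
import Data.List.Relation.Unary.All as All
import Data.List.Relation.Unary.Linked as Linked
open import Data.Product using (_×_; _,_; proj₁; proj₂)
open import Data.Sum using (inj₁; inj₂)
open import Data.Bool using (true; false; if_then_else_)
open import Data.Empty using (⊥-elim)
open import Function.Bundles using (_⇔_; mk⇔; Equivalence)
open import Relation.Nullary using (¬_; Dec; yes; no)
open import Relation.Nullary.Decidable using (⌊_⌋; isYes≗does; does-⇔)
import Relation.Binary.PropositionalEquality as ≡
open ≡ using (_≡_)

⌊⌋-⇔ : ∀ {p q} {A : Set p} {B : Set q} → A ⇔ B → (a? : Dec A) (b? : Dec B) → ⌊ a? ⌋ ≡ ⌊ b? ⌋
⌊⌋-⇔ A⇔B a? b? = ≡.trans (isYes≗does a?) (≡.trans (does-⇔ A⇔B a? b?) (≡.sym (isYes≗does b?)))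

partition-tail : ∀ {a ν} → IsPartition (a ∷ ν) → IsPartition ν
partition-tail (_ All.∷ pos , linked) = pos , Linked.tail linked

partition-head-pos : ∀ {a ν} → IsPartition (a ∷ ν) → 1 ≤ a
partition-head-pos (pos All.∷ _ , _) = pos

second≤first : ∀ {a ν} → IsPartition (a ∷ ν) → part ν 1 ≤ a
second≤first {ν = []}    _           = z≤n
second≤first {ν = _ ∷ _} (_ , linked) = Linked.head linked

part≤first : ∀ {ν} → IsPartition ν → ∀ i → part ν i ≤ part ν 1
part≤first _                zero          = z≤n
part≤first {[]}    _        (suc k)       = z≤n
part≤first {_ ∷ _} _        (suc zero)    = ℕₚ.≤-refl
part≤first {_ ∷ _} ip (suc (suc k)) =
  ℕₚ.≤-trans (part≤first (partition-tail ip) (suc k)) (second≤first ip)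

conj-cons : ∀ {a j} ν → j ≤ a → conj (a ∷ ν) j ≡ suc (conj ν j)
conj-cons {j = j} ν j≤a = ≡.cong length (Listₚ.filter-accept (j ≤?_) j≤a)

conj-beyond : ∀ {ν j} → IsPartition ν → part ν 1 < j → conj ν j ≡ 0
conj-beyond {[]}    _  _   = ≡.refl
conj-beyond {a ∷ ν} {j} ip a<j =
  ≡.trans (≡.cong length (Listₚ.filter-reject (j ≤?_) (ℕₚ.<⇒≱ a<j)))
          (conj-beyond (partition-tail ip) (ℕₚ.≤-<-trans (second≤first ip) a<j))

corner-row-pos : ∀ {ν r s} → IsCorner ν r s → 1 ≤ r
corner-row-pos ((1≤r , _) , _) = 1≤r

corner-col≡part : ∀ {ν r s} → IsCorner ν r s → s ≡ part ν r
corner-col≡part ((1≤r , _ , s≤λr) , _ , nothing-right) =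
  ℕₚ.≤-antisym s≤λr (ℕₚ.≮⇒≥ (λ s<λr → nothing-right (1≤r , s≤s z≤n , s<λr)))

corner-col≤first : ∀ {ν r s} → IsPartition ν → IsCorner ν r s → s ≤ part ν 1
corner-col≤first {ν} {r} ip cn =
  ≡.subst (_≤ part ν 1) (≡.sym (corner-col≡part cn)) (part≤first ip r)

corner-row≤length : ∀ {ν r s} → IsCorner ν r s → r ≤ length ν
corner-row≤length {ν} {suc k} ((_ , 1≤s , s≤λr) , _) = row-exists ν k (ℕₚ.≤-trans 1≤s s≤λr)
  where
  row-exists : ∀ ν k → 1 ≤ nth ν k → suc k ≤ length ν
  row-exists (_ ∷ _) zero    _   = s≤s z≤n
  row-exists (_ ∷ ν) (suc k) pos = s≤s (row-exists ν k pos)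

-- Below the first row, the corners of (a ∷ ν) are those of ν moved one row
-- down: membership of (i, j) in a diagram only depends on the length of row i.
corner-below-first-row : ∀ {a ν k s} → IsCorner (a ∷ ν) (suc (suc k)) s ⇔ IsCorner ν (suc k) s
corner-below-first-row = mk⇔
  (λ ((_ , d) , no-below , no-right) →
     (s≤s z≤n , d) , (λ (_ , e) → no-below (s≤s z≤n , e)) , (λ (_ , e) → no-right (s≤s z≤n , e)))
  (λ ((_ , d) , no-below , no-right) →
     (s≤s z≤n , d) , (λ (_ , e) → no-below (s≤s z≤n , e)) , (λ (_ , e) → no-right (s≤s z≤n , e)))

first-row-corner : ∀ {a ν} → IsPartition (a ∷ ν) → part ν 1 < a → IsCorner (a ∷ ν) 1 a
first-row-corner ip λ₂<a =
  (s≤s z≤n , partition-head-pos ip , ℕₚ.≤-refl)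
  , (λ (_ , _ , a≤λ₂) → ℕₚ.<⇒≱ λ₂<a a≤λ₂)
  , (λ (_ , _ , a<a) → ℕₚ.<-irrefl ≡.refl a<a)

first-row-no-corner : ∀ {a ν} → IsPartition (a ∷ ν) → part ν 1 ≡ a → ¬ IsCorner (a ∷ ν) 1 a
first-row-no-corner ip λ₂≡a (_ , nothing-below , _) =
  nothing-below (s≤s z≤n , partition-head-pos ip , ℕₚ.≤-reflexive (≡.sym λ₂≡a))

module FieldAlgebra {c ℓ : Level} (F : Field c ℓ) where
  open Field F hiding (zero)
  open import Relation.Binary.Reasoning.Setoid setoid
  open import Algebra.Solver.Ring.NaturalCoefficients.Default commutativeSemiring
    using (solve; _:=_; _:+_; _:*_)

  NonZero : Carrier → Set ℓ
  NonZero a = ¬ (a ≈ 0#)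

  nonzero-resp : ∀ {a b} → a ≈ b → NonZero a → NonZero b
  nonzero-resp a≈b a≉0 b≈0 = a≉0 (trans a≈b b≈0)

  inverseˡ : ∀ {a} → NonZero a → inv a * a ≈ 1#
  inverseˡ {a} a≉0 = trans (*-comm (inv a) a) (inverseʳ a a≉0)

  cancelˡ : ∀ {a} u → NonZero a → inv a * (a * u) ≈ u
  cancelˡ {a} u a≉0 = begin
    inv a * (a * u) ≈⟨ sym (*-assoc (inv a) a u) ⟩
    (inv a * a) * u ≈⟨ *-cong (inverseˡ a≉0) refl ⟩
    1# * u          ≈⟨ *-identityˡ u ⟩
    u               ∎

  solve-linear : ∀ {u v K} → NonZero K → K * u ≈ v → u ≈ inv K * v
  solve-linear {u} {v} {K} K≉0 Ku≈v = trans (sym (cancelˡ u K≉0)) (*-cong refl Ku≈v)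

  solve-linearʳ : ∀ {u v d} → NonZero d → u * d ≈ v → u ≈ v * inv d
  solve-linearʳ {u} {v} {d} d≉0 ud≈v =
    trans (solve-linear d≉0 (trans (*-comm d u) ud≈v)) (*-comm (inv d) v)

  product-inverse : ∀ {a b} → NonZero a → NonZero b → (a * b) * (inv a * inv b) ≈ 1#
  product-inverse {a} {b} a≉0 b≉0 = begin
    (a * b) * (inv a * inv b)   ≈⟨ swap-middle a b (inv a) (inv b) ⟩
    (a * inv a) * (b * inv b)   ≈⟨ *-cong (inverseʳ a a≉0) (inverseʳ b b≉0) ⟩
    1# * 1#                     ≈⟨ *-identityˡ 1# ⟩
    1#                          ∎
    where
    swap-middle : ∀ a b d e → (a * b) * (d * e) ≈ (a * d) * (b * e)
    swap-middle = solve 4 (λ a b d e → (a :* b) :* (d :* e) := (a :* d) :* (b :* e)) refl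

  nonzero-* : ∀ {a b} → NonZero a → NonZero b → NonZero (a * b)
  nonzero-* {a} {b} a≉0 b≉0 ab≈0 = 0≉1 (begin
    0#                          ≈⟨ sym (zeroˡ (inv a * inv b)) ⟩
    0# * (inv a * inv b)        ≈⟨ *-cong (sym ab≈0) refl ⟩
    (a * b) * (inv a * inv b)   ≈⟨ product-inverse a≉0 b≉0 ⟩
    1#                          ∎)

  inv-* : ∀ {a b} → NonZero a → NonZero b → inv (a * b) ≈ inv a * inv b
  inv-* {a} {b} a≉0 b≉0 = sym (begin
    inv a * inv b                           ≈⟨ sym (cancelˡ (inv a * inv b) (nonzero-* a≉0 b≉0)) ⟩
    inv (a * b) * ((a * b) * (inv a * inv b)) ≈⟨ *-cong refl (product-inverse a≉0 b≉0) ⟩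
    inv (a * b) * 1#                        ≈⟨ *-identityʳ (inv (a * b)) ⟩
    inv (a * b)                             ∎)

  -- (1 + u/D) D = u + D: the step behind every telescoping product below.
  one-plus-fraction-times : ∀ u {D} → NonZero D → (1# + u * inv D) * D ≈ u + D
  one-plus-fraction-times u {D} D≉0 = begin
    (1# + u * inv D) * D      ≈⟨ distribʳ D 1# (u * inv D) ⟩
    1# * D + (u * inv D) * D  ≈⟨ +-cong (*-identityˡ D) (*-assoc u (inv D) D) ⟩
    D + u * (inv D * D)       ≈⟨ +-cong refl (trans (*-cong refl (inverseˡ D≉0)) (*-identityʳ u)) ⟩
    D + u                     ≈⟨ +-comm D u ⟩
    u + D                     ∎

  one-plus-fraction : ∀ u {D} → NonZero D → 1# + u * inv D ≈ (u + D) * inv D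
  one-plus-fraction u D≉0 = solve-linearʳ D≉0 (one-plus-fraction-times u D≉0)

  partial-fractions : ∀ {B D W} → NonZero B → NonZero D → NonZero W → B + D ≈ W →
                      inv B * inv D ≈ inv W * (inv B + inv D)
  partial-fractions {B} {D} {W} B≉0 D≉0 W≉0 B+D≈W = solve-linear W≉0 (begin
    W * (inv B * inv D)                       ≈⟨ *-cong (sym B+D≈W) refl ⟩
    (B + D) * (inv B * inv D)                 ≈⟨ expand B D (inv B) (inv D) ⟩
    (B * inv B) * inv D + (D * inv D) * inv B ≈⟨ +-cong (cancel B≉0) (cancel D≉0) ⟩
    inv D + inv B                             ≈⟨ +-comm (inv D) (inv B) ⟩
    inv B + inv D                             ∎)
    where
    expand : ∀ b d ib id → (b + d) * (ib * id) ≈ (b * ib) * id + (d * id) * ib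
    expand = solve 4 (λ b d ib id → (b :+ d) :* (ib :* id) := (b :* ib) :* id :+ (d :* id) :* ib) refl
    cancel : ∀ {a w} → NonZero a → (a * inv a) * w ≈ w
    cancel {a} {w} a≉0 = trans (*-cong (inverseʳ a a≉0) refl) (*-identityˡ w)

  split-fraction : ∀ {A t D K M} → NonZero D → NonZero K → NonZero M → M ≈ D + K → K ≈ A + t →
                   ((A + D) * inv D) * inv M ≈ inv K * (A * inv D + t * inv M)
  split-fraction {A} {t} {D} {K} {M} D≉0 K≉0 M≉0 M≈D+K K≈A+t = solve-linear K≉0 (begin
    K * (((A + D) * inv D) * inv M)                   ≈⟨ reassociate K A D (inv D) (inv M) ⟩
    (K * (A + D)) * (inv D * inv M)                   ≈⟨ *-cong (sym numerator) refl ⟩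
    (A * M + t * D) * (inv D * inv M)                 ≈⟨ expand A M t D (inv D) (inv M) ⟩
    (A * inv D) * (M * inv M) + (t * inv M) * (D * inv D)
      ≈⟨ +-cong (trans (*-cong refl (inverseʳ M M≉0)) (*-identityʳ _))
                (trans (*-cong refl (inverseʳ D D≉0)) (*-identityʳ _)) ⟩
    A * inv D + t * inv M                             ∎)
    where
    reassociate : ∀ k a d id im → k * (((a + d) * id) * im) ≈ (k * (a + d)) * (id * im)
    reassociate = solve 5 (λ k a d id im → k :* (((a :+ d) :* id) :* im) := (k :* (a :+ d)) :* (id :* im)) refl
    expand : ∀ a m t d id im → (a * m + t * d) * (id * im) ≈ (a * id) * (m * im) + (t * im) * (d * id)
    expand = solve 6 (λ a m t d id im →
      (a :* m :+ t :* d) :* (id :* im) := (a :* id) :* (m :* im) :+ (t :* im) :* (d :* id)) refl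
    numerator : A * M + t * D ≈ K * (A + D)
    numerator = begin
      A * M + t * D          ≈⟨ +-cong (*-cong refl M≈D+K) refl ⟩
      A * (D + K) + t * D    ≈⟨ regroup A t D K ⟩
      (A + t) * D + A * K    ≈⟨ +-cong (*-cong (sym K≈A+t) refl) refl ⟩
      K * D + A * K          ≈⟨ factor K D A ⟩
      K * (A + D)            ∎
      where
      regroup : ∀ a t d k → a * (d + k) + t * d ≈ (a + t) * d + a * k
      regroup = solve 4 (λ a t d k → a :* (d :+ k) :+ t :* d := (a :+ t) :* d :+ a :* k) refl
      factor : ∀ k d a → k * d + a * k ≈ k * (a + d)
      factor = solve 3 (λ k d a → k :* d :+ a :* k := k :* (a :+ d)) refl

module FiniteSums {c ℓ : Level} (F : Field c ℓ) where
  open Field F hiding (zero)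
  open FieldDefs F
  open FieldAlgebra F
  open import Relation.Binary.Reasoning.Setoid setoid
  open import Algebra.Solver.Ring.NaturalCoefficients.Default commutativeSemiring
    using (solve; _:=_; _:+_)

  Range : ℕ → ℕ → ℕ → Set
  Range a n k = a ≤ k × k < a +ℕ n

  range-first : ∀ a n → Range a (suc n) a
  range-first a n = ℕₚ.≤-refl , ℕₚ.m<m+n a (s≤s z≤n)

  range-rest : ∀ {a n k} → Range (suc a) n k → Range a (suc n) k
  range-rest {a} {n} {k} (a<k , k<1+a+n) = ℕₚ.<⇒≤ a<k , ≡.subst (k <_) (≡.sym (ℕₚ.+-suc a n)) k<1+a+n

  sumFrom-shift : ∀ a n (f : ℕ → Carrier) → sumFrom (suc a) n f ≡ sumFrom a n (λ k → f (suc k))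
  sumFrom-shift a zero    f = ≡.refl
  sumFrom-shift a (suc n) f = ≡.cong (f (suc a) +_) (sumFrom-shift (suc a) n f)

  prodFrom-shift : ∀ a n (f : ℕ → Carrier) → prodFrom (suc a) n f ≡ prodFrom a n (λ k → f (suc k))
  prodFrom-shift a zero    f = ≡.refl
  prodFrom-shift a (suc n) f = ≡.cong (f (suc a) *_) (prodFrom-shift (suc a) n f)

  sumFrom-cong : ∀ a n {f g : ℕ → Carrier} → (∀ k → Range a n k → f k ≈ g k) →
                 sumFrom a n f ≈ sumFrom a n g
  sumFrom-cong a zero    f≈g = refl
  sumFrom-cong a (suc n) f≈g =
    +-cong (f≈g a (range-first a n)) (sumFrom-cong (suc a) n (λ k r → f≈g k (range-rest r)))

  prodFrom-cong : ∀ a n {f g : ℕ → Carrier} → (∀ k → Range a n k → f k ≈ g k) →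
                  prodFrom a n f ≈ prodFrom a n g
  prodFrom-cong a zero    f≈g = refl
  prodFrom-cong a (suc n) f≈g =
    *-cong (f≈g a (range-first a n)) (prodFrom-cong (suc a) n (λ k r → f≈g k (range-rest r)))

  sumFrom-zero : ∀ a n {f} → (∀ k → Range a n k → f k ≈ 0#) → sumFrom a n f ≈ 0#
  sumFrom-zero a n {f} f≈0 = trans (sumFrom-cong a n f≈0) (all-zero a n)
    where
    all-zero : ∀ a n → sumFrom a n (λ _ → 0#) ≈ 0#
    all-zero a zero    = refl
    all-zero a (suc n) = trans (+-identityˡ _) (all-zero (suc a) n)

  sumFrom-split : ∀ a m n f → sumFrom a (m +ℕ n) f ≈ sumFrom a m f + sumFrom (a +ℕ m) n f
  sumFrom-split a zero n f rewrite ℕₚ.+-identityʳ a = sym (+-identityˡ _)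
  sumFrom-split a (suc m) n f rewrite ℕₚ.+-suc a m =
    trans (+-cong refl (sumFrom-split (suc a) m n f)) (sym (+-assoc _ _ _))

  prodFrom-split : ∀ a m n f → prodFrom a (m +ℕ n) f ≈ prodFrom a m f * prodFrom (a +ℕ m) n f
  prodFrom-split a zero n f rewrite ℕₚ.+-identityʳ a = sym (*-identityˡ _)
  prodFrom-split a (suc m) n f rewrite ℕₚ.+-suc a m =
    trans (*-cong refl (prodFrom-split (suc a) m n f)) (sym (*-assoc _ _ _))

  sumFrom-scale : ∀ a n u f → sumFrom a n (λ k → u * f k) ≈ u * sumFrom a n f
  sumFrom-scale a zero    u f = sym (zeroʳ u)
  sumFrom-scale a (suc n) u f =
    trans (+-cong refl (sumFrom-scale (suc a) n u f)) (sym (distribˡ u _ _))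

  sumFrom-+ : ∀ a n f g → sumFrom a n (λ k → f k + g k) ≈ sumFrom a n f + sumFrom a n g
  sumFrom-+ a zero    f g = sym (+-identityˡ 0#)
  sumFrom-+ a (suc n) f g =
    trans (+-cong refl (sumFrom-+ (suc a) n f g)) (interchange (f a) (g a) _ _)
    where
    interchange : ∀ p q r s → (p + q) + (r + s) ≈ (p + r) + (q + s)
    interchange = solve 4 (λ p q r s → (p :+ q) :+ (r :+ s) := (p :+ r) :+ (q :+ s)) refl

  Σ-empty : ∀ f a → Σ[ suc a ⋯ a ] f ≈ 0#
  Σ-empty f a = reflexive (≡.cong (λ n → sumFrom (suc a) n f) (ℕₚ.n∸n≡0 a))

  Σ-shift : ∀ f i r → Σ[ suc i ⋯ suc r ] f ≡ Σ[ i ⋯ r ] (λ k → f (suc k))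
  Σ-shift f i r = sumFrom-shift i (suc r ∸ i) f

  Σ-first : ∀ f r → Σ[ 1 ⋯ suc r ] f ≡ f 1 + Σ[ 1 ⋯ r ] (λ k → f (suc k))
  Σ-first f r = ≡.cong (f 1 +_) (sumFrom-shift 1 r f)

  Σ-peel : ∀ f {j a} → j ≤ a → Σ[ j ⋯ a ] f ≡ f j + Σ[ suc j ⋯ a ] f
  Σ-peel f {j} j≤a = ≡.cong (λ n → sumFrom j n f) (ℕₚ.+-∸-assoc 1 j≤a)

  -- The tails T + f_j + … + f_a satisfy the recursion of `telescope` below.
  tail-step : ∀ f T {j a} → j ≤ a → T + Σ[ j ⋯ a ] f ≈ f j + (T + Σ[ suc j ⋯ a ] f)
  tail-step f T {j} {a} j≤a = begin
    T + Σ[ j ⋯ a ] f                   ≡⟨ ≡.cong (T +_) (Σ-peel f j≤a) ⟩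
    T + (f j + Σ[ suc j ⋯ a ] f)       ≈⟨ sym (+-assoc T (f j) _) ⟩
    (T + f j) + Σ[ suc j ⋯ a ] f       ≈⟨ +-cong (+-comm T (f j)) refl ⟩
    (f j + T) + Σ[ suc j ⋯ a ] f       ≈⟨ +-assoc (f j) T _ ⟩
    f j + (T + Σ[ suc j ⋯ a ] f)       ∎

  Σ-split : ∀ f {s m a} → s ≤ m → m ≤ a → Σ[ suc s ⋯ a ] f ≈ Σ[ suc s ⋯ m ] f + Σ[ suc m ⋯ a ] f
  Σ-split f {s} {m} {a} s≤m m≤a = begin
    sumFrom (suc s) (a ∸ s) f
      ≡⟨ ≡.cong (λ n → sumFrom (suc s) n f) lengths ⟩
    sumFrom (suc s) ((m ∸ s) +ℕ (a ∸ m)) f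
      ≈⟨ sumFrom-split (suc s) (m ∸ s) (a ∸ m) f ⟩
    sumFrom (suc s) (m ∸ s) f + sumFrom (suc s +ℕ (m ∸ s)) (a ∸ m) f
      ≡⟨ ≡.cong (λ k → sumFrom (suc s) (m ∸ s) f + sumFrom (suc k) (a ∸ m) f) (ℕₚ.m+[n∸m]≡n s≤m) ⟩
    sumFrom (suc s) (m ∸ s) f + sumFrom (suc m) (a ∸ m) f ∎
    where
    lengths : a ∸ s ≡ (m ∸ s) +ℕ (a ∸ m)
    lengths = ≡.trans (≡.cong (_∸ s) (≡.sym (ℕₚ.m+[n∸m]≡n m≤a))) (ℕₚ.+-∸-comm (a ∸ m) s≤m)

  -- Telescoping: if S j = y j + S (j+1), the factors 1 + y_j/S_{j+1} = S_j/S_{j+1}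
  -- collapse, S_{b+n} ∏_{j=b}^{b+n-1} (1 + y_j/S_{j+1}) = S_b.
  telescope : ∀ (y S : ℕ → Carrier) n b →
              (∀ j → Range b n j → S j ≈ y j + S (suc j)) →
              (∀ j → Range b n j → NonZero (S (suc j))) →
              S (b +ℕ n) * prodFrom b n (λ j → 1# + y j * inv (S (suc j))) ≈ S b
  telescope y S zero b _ _ = trans (*-identityʳ _) (reflexive (≡.cong S (ℕₚ.+-identityʳ b)))
  telescope y S (suc n) b step S≉0 = begin
    S (b +ℕ suc n) * (factor b * rest)  ≡⟨ ≡.cong (λ k → S k * (factor b * rest)) (ℕₚ.+-suc b n) ⟩
    S (suc b +ℕ n) * (factor b * rest)  ≈⟨ rotate (S (suc b +ℕ n)) (factor b) rest ⟩
    factor b * (S (suc b +ℕ n) * rest)  ≈⟨ *-cong refl (telescope y S n (suc b)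
                                              (λ j r → step j (range-rest r)) (λ j r → S≉0 j (range-rest r))) ⟩
    factor b * S (suc b)                ≈⟨ one-plus-fraction-times (y b) (S≉0 b (range-first b n)) ⟩
    y b + S (suc b)                     ≈⟨ sym (step b (range-first b n)) ⟩
    S b                                 ∎
    where
    factor : ℕ → Carrier
    factor j = 1# + y j * inv (S (suc j))
    rest : Carrier
    rest = prodFrom (suc b) n factor
    rotate : ∀ s f p → s * (f * p) ≈ f * (s * p)
    rotate s f p = trans (sym (*-assoc s f p)) (trans (*-cong (*-comm s f) refl) (*-assoc f s p))

module CornerSums {c ℓ : Level} (F : Field c ℓ) where
  open Field F hiding (zero)
  open FieldDefs F
  open FiniteSums F
  open import Relation.Binary.Reasoning.Setoid setoid

  atCorner : List ℕ → (ℕ → ℕ → Carrier) → ℕ → ℕ → Carrier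
  atCorner λs f r s = if ⌊ isCorner? λs r s ⌋ then f r s else 0#

  -- The corner sum of Defs (which does not depend on x and y).
  CornerSum : List ℕ → (ℕ → ℕ → Carrier) → Carrier
  CornerSum λs f = Σ[ 1 ⋯ length λs ] (λ r → Σ[ 1 ⋯ part λs 1 ] (atCorner λs f r))

  if-cong : ∀ {A : Set} (a? : Dec A) {u v} → (A → u ≈ v) →
            (if ⌊ a? ⌋ then u else 0#) ≈ (if ⌊ a? ⌋ then v else 0#)
  if-cong (yes a) u≈v = u≈v a
  if-cong (no _)  _   = refl

  if-yes : ∀ {A : Set} (a? : Dec A) {u} → A → (if ⌊ a? ⌋ then u else 0#) ≈ u
  if-yes (yes _) _ = refl
  if-yes (no ¬a) a = ⊥-elim (¬a a)

  if-no : ∀ {A : Set} (a? : Dec A) {u} → ¬ A → (if ⌊ a? ⌋ then u else 0#) ≈ 0#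
  if-no (yes a) ¬a = ⊥-elim (¬a a)
  if-no (no _)  _  = refl

  if-+ : ∀ b u v → (if b then u + v else 0#) ≈ (if b then u else 0#) + (if b then v else 0#)
  if-+ true  u v = refl
  if-+ false u v = sym (+-identityˡ 0#)

  if-* : ∀ b w u → (if b then w * u else 0#) ≈ w * (if b then u else 0#)
  if-* true  w u = refl
  if-* false w u = sym (zeroʳ w)

  cornerSum-cong : ∀ λs {f g} → (∀ r s → IsCorner λs r s → f r s ≈ g r s) →
                   CornerSum λs f ≈ CornerSum λs g
  cornerSum-cong λs f≈g = sumFrom-cong 1 (length λs) (λ r _ → sumFrom-cong 1 (part λs 1) (λ s _ →
    if-cong (isCorner? λs r s) (f≈g r s)))

  cornerSum-+ : ∀ λs f g → CornerSum λs (λ r s → f r s + g r s) ≈ CornerSum λs f + CornerSum λs g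
  cornerSum-+ λs f g = trans
    (sumFrom-cong 1 (length λs) (λ r _ →
      trans (sumFrom-cong 1 (part λs 1) (λ s _ → if-+ _ _ _)) (sumFrom-+ 1 (part λs 1) _ _)))
    (sumFrom-+ 1 (length λs) _ _)

  cornerSum-scale : ∀ λs w f → CornerSum λs (λ r s → w * f r s) ≈ w * CornerSum λs f
  cornerSum-scale λs w f = trans
    (sumFrom-cong 1 (length λs) (λ r _ →
      trans (sumFrom-cong 1 (part λs 1) (λ s _ → if-* _ _ _)) (sumFrom-scale 1 (part λs 1) w _)))
    (sumFrom-scale 1 (length λs) w _)

  first-row-sum : ∀ {a ν} → IsPartition (a ∷ ν) → ∀ f →
                  Σ[ 1 ⋯ a ] (atCorner (a ∷ ν) f 1) ≈ atCorner (a ∷ ν) f 1 a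
  first-row-sum {zero}   {ν} ip f = ⊥-elim (ℕₚ.<-irrefl ≡.refl (partition-head-pos ip))
  first-row-sum {suc a₀} {ν} ip f = begin
    sumFrom 1 (suc a₀) row          ≡⟨ ≡.cong (λ n → sumFrom 1 n row) (ℕₚ.+-comm 1 a₀) ⟩
    sumFrom 1 (a₀ +ℕ 1) row         ≈⟨ sumFrom-split 1 a₀ 1 row ⟩
    sumFrom 1 a₀ row + (row (suc a₀) + 0#)
      ≈⟨ +-cong (sumFrom-zero 1 a₀ not-corner) (+-identityʳ _) ⟩
    0# + row (suc a₀)               ≈⟨ +-identityˡ _ ⟩
    row (suc a₀)                    ∎
    where
    row = atCorner (suc a₀ ∷ ν) f 1
    not-corner : ∀ s → Range 1 a₀ s → row s ≈ 0#
    not-corner s (_ , s<1+a₀) = if-no (isCorner? (suc a₀ ∷ ν) 1 s)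
      (λ cn → ℕₚ.<-irrefl (corner-col≡part {suc a₀ ∷ ν} cn) s<1+a₀)

  lower-row-sum : ∀ {a ν} → IsPartition (a ∷ ν) → ∀ k f →
                  Σ[ 1 ⋯ a ] (atCorner (a ∷ ν) f (suc (suc k)))
                    ≈ Σ[ 1 ⋯ part ν 1 ] (atCorner ν (λ r → f (suc r)) (suc k))
  lower-row-sum {a} {ν} ip k f = begin
    sumFrom 1 a row
      ≡⟨ ≡.cong (λ n → sumFrom 1 n row) (≡.sym (ℕₚ.m+[n∸m]≡n (second≤first ip))) ⟩
    sumFrom 1 (part ν 1 +ℕ (a ∸ part ν 1)) row
      ≈⟨ sumFrom-split 1 (part ν 1) (a ∸ part ν 1) row ⟩
    sumFrom 1 (part ν 1) row + sumFrom (suc (part ν 1)) (a ∸ part ν 1) row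
      ≈⟨ +-cong (sumFrom-cong 1 (part ν 1) same-corners) (sumFrom-zero _ _ beyond-ν₁) ⟩
    sumFrom 1 (part ν 1) (atCorner ν (λ r → f (suc r)) (suc k)) + 0#
      ≈⟨ +-identityʳ _ ⟩
    sumFrom 1 (part ν 1) (atCorner ν (λ r → f (suc r)) (suc k)) ∎
    where
    row = atCorner (a ∷ ν) f (suc (suc k))
    same-corners : ∀ s → Range 1 (part ν 1) s → row s ≈ atCorner ν (λ r → f (suc r)) (suc k) s
    same-corners s _ = reflexive (≡.cong (λ b → if b then f (suc (suc k)) s else 0#)
      (⌊⌋-⇔ (corner-below-first-row {a} {ν} {k} {s}) (isCorner? (a ∷ ν) (suc (suc k)) s) (isCorner? ν (suc k) s)))
    beyond-ν₁ : ∀ s → Range (suc (part ν 1)) (a ∸ part ν 1) s → row s ≈ 0#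
    beyond-ν₁ s (ν₁<s , _) = if-no (isCorner? (a ∷ ν) (suc (suc k)) s)
      (λ cn → ℕₚ.<⇒≱ ν₁<s (corner-col≤first (partition-tail ip)
                             (Equivalence.to (corner-below-first-row {a} {ν} {k} {s}) cn)))

  cornerSum-first-row : ∀ {a ν} → IsPartition (a ∷ ν) → ∀ f →
    CornerSum (a ∷ ν) f ≈ atCorner (a ∷ ν) f 1 a + CornerSum ν (λ r s → f (suc r) s)
  cornerSum-first-row {a} {ν} ip f = +-cong (first-row-sum ip f) (begin
    sumFrom 2 (length ν) rows                 ≡⟨ sumFrom-shift 1 (length ν) rows ⟩
    sumFrom 1 (length ν) (λ r → rows (suc r)) ≈⟨ sumFrom-cong 1 (length ν) lower-rows ⟩
    CornerSum ν (λ r s → f (suc r) s)         ∎)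
    where
    rows : ℕ → Carrier
    rows r = Σ[ 1 ⋯ a ] (atCorner (a ∷ ν) f r)
    lower-rows : ∀ r → Range 1 (length ν) r →
                 rows (suc r) ≈ Σ[ 1 ⋯ part ν 1 ] (atCorner ν (λ r s → f (suc r) s) r)
    lower-rows (suc k) _ = lower-row-sum ip k f

  cornerSum-new-corner : ∀ {a ν} → IsPartition (a ∷ ν) → part ν 1 < a → ∀ f →
    CornerSum (a ∷ ν) f ≈ f 1 a + CornerSum ν (λ r s → f (suc r) s)
  cornerSum-new-corner {a} {ν} ip ν₁<a f = trans (cornerSum-first-row ip f)
    (+-cong (if-yes (isCorner? (a ∷ ν) 1 a) (first-row-corner ip ν₁<a)) refl)

  cornerSum-no-new-corner : ∀ {a ν} → IsPartition (a ∷ ν) → part ν 1 ≡ a → ∀ f →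
    CornerSum (a ∷ ν) f ≈ CornerSum ν (λ r s → f (suc r) s)
  cornerSum-no-new-corner {a} {ν} ip ν₁≡a f = trans (cornerSum-first-row ip f)
    (trans (+-cong (if-no (isCorner? (a ∷ ν) 1 a) (first-row-no-corner ip ν₁≡a)) refl) (+-identityˡ _))

-- The induction.  The variables y stay fixed; λ and x vary (x is shifted
-- whenever the first row is removed).
module Induction {c ℓ : Level} (F : Field c ℓ) (y : ℕ → Field.Carrier F) where
  open Field F hiding (zero)
  open FieldDefs F
  open FieldAlgebra F
  open FiniteSums F
  open CornerSums F
  open import Relation.Binary.Reasoning.Setoid setoid
  open import Algebra.Solver.Ring.NaturalCoefficients.Default commutativeSemiring
    using (solve; _:=_; _:+_; _:*_; con)

  Y : List ℕ → Carrier
  Y λs = Σ[ 1 ⋯ part λs 1 ] y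

  C̃ : List ℕ → (ℕ → Carrier) → ℕ → Carrier
  C̃ λs x j = Σ[ 1 ⋯ conj λs j ] x + Σ[ suc j ⋯ part λs 1 ] y

  G : List ℕ → (ℕ → Carrier) → Carrier → Carrier
  G λs x t = Π[ 1 ⋯ part λs 1 ] (λ j → 1# + y j * inv (C̃ λs x j + t))

  GDefined : List ℕ → (ℕ → Carrier) → Carrier → Set ℓ
  GDefined λs x t = ∀ j → Range 1 (part λs 1) j → NonZero (C̃ λs x j + t)

  G-cong : ∀ λs x {t t′} → t ≈ t′ → G λs x t ≈ G λs x t′
  G-cong λs x t≈t′ = prodFrom-cong 1 (part λs 1) (λ j _ →
    +-cong refl (*-cong refl (inv-cong (+-cong refl t≈t′))))

  GDefined-resp : ∀ λs x {t t′} → t ≈ t′ → GDefined λs x t → GDefined λs x t′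
  GDefined-resp λs x t≈t′ G-def j r = nonzero-resp (+-cong refl t≈t′) (G-def j r)

  B+C : ∀ {λs} x {r s} → IsPartition λs → IsCorner λs r s →
        let open Identities λs x y in B r s + C r s ≈ Σ[ 1 ⋯ ℓλ ] x + Y λs
  B+C {λs} x {r} {s} ip cn = begin
    (Σ[ suc r ⋯ length λs ] x + Σ[ 1 ⋯ s ] y) + (Σ[ 1 ⋯ r ] x + Σ[ suc s ⋯ part λs 1 ] y)
      ≈⟨ interchange _ _ _ _ ⟩
    (Σ[ 1 ⋯ r ] x + Σ[ suc r ⋯ length λs ] x) + (Σ[ 1 ⋯ s ] y + Σ[ suc s ⋯ part λs 1 ] y)
      ≈⟨ +-cong (sym (Σ-split x z≤n (corner-row≤length cn))) (sym (Σ-split y z≤n (corner-col≤first ip cn))) ⟩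
    Σ[ 1 ⋯ length λs ] x + Y λs ∎
    where
    interchange : ∀ p q u w → (p + q) + (u + w) ≈ (u + p) + (q + w)
    interchange = solve 4 (λ p q u w → (p :+ q) :+ (u :+ w) := (u :+ p) :+ (q :+ w)) refl

  module RowRemoval (a : ℕ) (ν : List ℕ) (x : ℕ → Carrier) (ip : IsPartition (a ∷ ν)) where
    x′ : ℕ → Carrier
    x′ k = x (suc k)

    module L = Identities (a ∷ ν) x y
    module N = Identities ν x′ y

    ν₁ : ℕ
    ν₁ = part ν 1

    β : Carrier
    β = Σ[ suc ν₁ ⋯ a ] y

    ν₁≤a : ν₁ ≤ a
    ν₁≤a = second≤first ip

    ν-partition : IsPartition ν
    ν-partition = partition-tail ip

    corner-down : ∀ {r s} → IsCorner ν r s → IsCorner (a ∷ ν) (suc r) s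
    corner-down {suc k} {s} = Equivalence.from (corner-below-first-row {a} {ν} {k} {s})

    col≤ν₁ : ∀ {r s} → IsCorner ν r s → s ≤ ν₁
    col≤ν₁ = corner-col≤first ν-partition

    range≤ν₁ : ∀ {j} → Range 1 ν₁ j → j ≤ ν₁
    range≤ν₁ (_ , j<1+ν₁) = ℕₚ.≤-pred j<1+ν₁

    C-shift : ∀ {r s} → IsCorner ν r s → L.C (suc r) s ≈ x 1 + (N.C r s + β)
    C-shift {r} {s} cn = begin
      Σ[ 1 ⋯ suc r ] x + Σ[ suc s ⋯ a ] y
        ≈⟨ +-cong (reflexive (Σ-first x r)) (Σ-split y (col≤ν₁ cn) ν₁≤a) ⟩
      (x 1 + Σ[ 1 ⋯ r ] x′) + (Σ[ suc s ⋯ ν₁ ] y + β) ≈⟨ regroup _ _ _ _ ⟩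
      x 1 + (N.C r s + β)                             ∎
      where
      regroup : ∀ p q u w → (p + q) + (u + w) ≈ p + ((q + u) + w)
      regroup = solve 4 (λ p q u w → (p :+ q) :+ (u :+ w) := p :+ ((q :+ u) :+ w)) refl

    Dx-first : ∀ {r s} → IsCorner ν r s → L.Dx (suc r) s 1 ≈ N.C r s + β
    Dx-first {r} {s} cn = begin
      Σ[ 2 ⋯ suc r ] x + Σ[ suc s ⋯ a ] y
        ≈⟨ +-cong (reflexive (Σ-shift x 1 r)) (Σ-split y (col≤ν₁ cn) ν₁≤a) ⟩
      Σ[ 1 ⋯ r ] x′ + (Σ[ suc s ⋯ ν₁ ] y + β) ≈⟨ sym (+-assoc _ _ _) ⟩
      N.C r s + β                             ∎

    B-shift : ∀ r s → L.B (suc r) s ≡ N.B r s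
    B-shift r s = ≡.cong (_+ Σ[ 1 ⋯ s ] y) (Σ-shift x (suc r) (length ν))

    Dx-shift : ∀ r s k → L.Dx (suc r) s (suc (suc k)) ≡ N.Dx r s (suc k)
    Dx-shift r s k = ≡.cong (_+ Σ[ suc s ⋯ part ν (suc k) ] y) (Σ-shift x (suc (suc k)) r)

    Dy-shift : ∀ r s j → j ≤ a → L.Dy (suc r) s j ≡ N.Dy r s j
    Dy-shift r s j j≤a = ≡.trans
      (≡.cong (λ m → Σ[ suc (suc r) ⋯ m ] x + Σ[ suc j ⋯ s ] y) (conj-cons ν j≤a))
      (≡.cong (_+ Σ[ suc j ⋯ s ] y) (Σ-shift x (suc r) (conj ν j)))

    Π-shift : ∀ {r s} → IsCorner ν r s →
              L.Π (suc r) s ≈ N.Π r s * (1# + x 1 * inv (L.Dx (suc r) s 1))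
    Π-shift {suc k} {s} cn = begin
      ((x (suc (suc k)) * y s) * (fxλ 1 * prodFrom 2 k fxλ)) * prodFrom 1 (s ∸ 1) fyλ
        ≈⟨ *-cong (*-cong refl (*-cong refl x-factors)) (prodFrom-cong 1 (s ∸ 1) y-factors) ⟩
      ((x′ (suc k) * y s) * (fxλ 1 * prodFrom 1 k fxν)) * prodFrom 1 (s ∸ 1) fyν
        ≈⟨ pull-out _ _ _ _ ⟩
      N.Π (suc k) s * fxλ 1 ∎
      where
      fxλ = λ i → 1# + x i * inv (L.Dx (suc (suc k)) s i)
      fyλ = λ j → 1# + y j * inv (L.Dy (suc (suc k)) s j)
      fxν = λ i → 1# + x′ i * inv (N.Dx (suc k) s i)
      fyν = λ j → 1# + y j * inv (N.Dy (suc k) s j)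
      x-factors : prodFrom 2 k fxλ ≈ prodFrom 1 k fxν
      x-factors = trans (reflexive (prodFrom-shift 1 k fxλ)) (prodFrom-cong 1 k (λ where
        (suc i) _ → reflexive (≡.cong (λ d → 1# + x (suc (suc i)) * inv d) (Dx-shift (suc k) s i))))
      y-factors : ∀ j → Range 1 (s ∸ 1) j → fyλ j ≈ fyν j
      y-factors j (_ , j<s) = reflexive (≡.cong (λ d → 1# + y j * inv d) (Dy-shift (suc k) s j
        (ℕₚ.≤-trans (ℕₚ.≤-trans (ℕₚ.≤-pred j<s) (ℕₚ.m∸n≤m s 1)) (ℕₚ.≤-trans (col≤ν₁ cn) ν₁≤a))))
      pull-out : ∀ u e p q → (u * (e * p)) * q ≈ ((u * p) * q) * e
      pull-out = solve 4 (λ u e p q → (u :* (e :* p)) :* q := ((u :* p) :* q) :* e) refl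

    ΠDefined-tail : L.ΠDefined → N.ΠDefined
    ΠDefined-tail Π-def (suc k) s cn = x-denominators , y-denominators
      where
      defined-λ = Π-def (suc (suc k)) s (corner-down cn)
      x-denominators : ∀ i → 1 ≤ i → i < suc k → NonZero (N.Dx (suc k) s i)
      x-denominators (suc i) _ i<k =
        ≡.subst NonZero (Dx-shift (suc k) s i) (proj₁ defined-λ (suc (suc i)) (s≤s z≤n) (s≤s i<k))
      y-denominators : ∀ j → 1 ≤ j → j < s → NonZero (N.Dy (suc k) s j)
      y-denominators j 1≤j j<s = ≡.subst NonZero
        (Dy-shift (suc k) s j (ℕₚ.≤-trans (ℕₚ.<⇒≤ j<s) (ℕₚ.≤-trans (col≤ν₁ cn) ν₁≤a)))
        (proj₂ defined-λ j 1≤j j<s)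

    BDefined-tail : L.BDefined → N.BDefined
    BDefined-tail B-def (suc k) s cn = ≡.subst NonZero (B-shift (suc k) s) (B-def (suc (suc k)) s (corner-down cn))

    C̃-shift : ∀ j → Range 1 ν₁ j → C̃ (a ∷ ν) x j ≈ C̃ ν x′ j + (x 1 + β)
    C̃-shift j r = begin
      Σ[ 1 ⋯ conj (a ∷ ν) j ] x + Σ[ suc j ⋯ a ] y
        ≡⟨ ≡.cong (λ m → Σ[ 1 ⋯ m ] x + Σ[ suc j ⋯ a ] y) (conj-cons ν (ℕₚ.≤-trans (range≤ν₁ r) ν₁≤a)) ⟩
      Σ[ 1 ⋯ suc (conj ν j) ] x + Σ[ suc j ⋯ a ] y
        ≈⟨ +-cong (reflexive (Σ-first x (conj ν j))) (Σ-split y (range≤ν₁ r) ν₁≤a) ⟩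
      (x 1 + Σ[ 1 ⋯ conj ν j ] x′) + (Σ[ suc j ⋯ ν₁ ] y + β) ≈⟨ regroup _ _ _ _ ⟩
      C̃ ν x′ j + (x 1 + β) ∎
      where
      regroup : ∀ p q u w → (p + q) + (u + w) ≈ (q + u) + (p + w)
      regroup = solve 4 (λ p q u w → (p :+ q) :+ (u :+ w) := (q :+ u) :+ (p :+ w)) refl

    C̃-shift+ : ∀ t j → Range 1 ν₁ j → C̃ (a ∷ ν) x j + t ≈ C̃ ν x′ j + ((x 1 + β) + t)
    C̃-shift+ t j r = trans (+-cong (C̃-shift j r) refl) (+-assoc _ _ _)

    GDefined-tail : ∀ t → GDefined (a ∷ ν) x t → GDefined ν x′ ((x 1 + β) + t)
    GDefined-tail t G-def j r =
      nonzero-resp (C̃-shift+ t j r) (G-def j (proj₁ r , s≤s (ℕₚ.≤-trans (range≤ν₁ r) ν₁≤a)))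

    G-low : ∀ t → prodFrom 1 ν₁ (λ j → 1# + y j * inv (C̃ (a ∷ ν) x j + t)) ≈ G ν x′ ((x 1 + β) + t)
    G-low t = prodFrom-cong 1 ν₁ (λ j r → +-cong refl (*-cong refl (inv-cong (C̃-shift+ t j r))))

    cellSum-first-row : L.cellSum ≈ x 1 * Y (a ∷ ν) + N.cellSum
    cellSum-first-row = +-cong (sumFrom-scale 1 a (x 1) y)
      (trans (reflexive (sumFrom-shift 1 (length ν) row)) (sumFrom-cong 1 (length ν) (λ where
        (suc k) _ → refl)))
      where
      row = λ p → Σ[ 1 ⋯ part (a ∷ ν) p ] (λ q → x p * y q)

    Y-first-row : Y (a ∷ ν) ≈ Y ν + β
    Y-first-row = Σ-split y z≤n ν₁≤a

    X-first-row : Σ[ 1 ⋯ L.ℓλ ] x ≡ x 1 + Σ[ 1 ⋯ N.ℓλ ] x′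
    X-first-row = Σ-first x (length ν)

    module NewCorner (ν₁<a : ν₁ < a) where
      new-corner : IsCorner (a ∷ ν) 1 a
      new-corner = first-row-corner ip ν₁<a

      C-new : L.C 1 a ≈ x 1
      C-new = trans (+-cong (+-identityʳ (x 1)) (Σ-empty y a)) (+-identityʳ (x 1))

      B-new : L.B 1 a ≈ Σ[ 1 ⋯ N.ℓλ ] x′ + (Y ν + β)
      B-new = trans (reflexive (≡.cong (_+ Y (a ∷ ν)) (Σ-shift x 1 (length ν)))) (+-cong refl Y-first-row)

      conj-high : ∀ {j} → ν₁ < j → j ≤ a → conj (a ∷ ν) j ≡ 1
      conj-high ν₁<j j≤a = ≡.trans (conj-cons ν j≤a) (≡.cong suc (conj-beyond ν-partition ν₁<j))

      Dy-low : ∀ j → Range 1 ν₁ j → L.Dy 1 a j ≈ C̃ ν x′ j + β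
      Dy-low j r = begin
        Σ[ 2 ⋯ conj (a ∷ ν) j ] x + Σ[ suc j ⋯ a ] y
          ≡⟨ ≡.cong (λ m → Σ[ 2 ⋯ m ] x + Σ[ suc j ⋯ a ] y) (conj-cons ν (ℕₚ.≤-trans (range≤ν₁ r) ν₁≤a)) ⟩
        Σ[ 2 ⋯ suc (conj ν j) ] x + Σ[ suc j ⋯ a ] y
          ≈⟨ +-cong (reflexive (Σ-shift x 1 (conj ν j))) (Σ-split y (range≤ν₁ r) ν₁≤a) ⟩
        Σ[ 1 ⋯ conj ν j ] x′ + (Σ[ suc j ⋯ ν₁ ] y + β) ≈⟨ sym (+-assoc _ _ _) ⟩
        C̃ ν x′ j + β ∎

      Dy-high : ∀ {j} → ν₁ < j → j ≤ a → L.Dy 1 a j ≈ Σ[ suc j ⋯ a ] y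
      Dy-high {j} ν₁<j j≤a = trans
        (reflexive (≡.cong (λ m → Σ[ 2 ⋯ m ] x + Σ[ suc j ⋯ a ] y) (conj-high ν₁<j j≤a)))
        (+-identityˡ _)

      C̃-high : ∀ t {j} → ν₁ < j → j ≤ a → C̃ (a ∷ ν) x j + t ≈ (t + x 1) + Σ[ suc j ⋯ a ] y
      C̃-high t {j} ν₁<j j≤a = begin
        (Σ[ 1 ⋯ conj (a ∷ ν) j ] x + Σ[ suc j ⋯ a ] y) + t
          ≡⟨ ≡.cong (λ m → (Σ[ 1 ⋯ m ] x + Σ[ suc j ⋯ a ] y) + t) (conj-high ν₁<j j≤a) ⟩
        ((x 1 + 0#) + Σ[ suc j ⋯ a ] y) + t   ≈⟨ +-cong (+-cong (+-identityʳ (x 1)) refl) refl ⟩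
        (x 1 + Σ[ suc j ⋯ a ] y) + t          ≈⟨ regroup _ _ _ ⟩
        (t + x 1) + Σ[ suc j ⋯ a ] y          ∎
        where
        regroup : ∀ p q u → (p + q) + u ≈ (u + p) + q
        regroup = solve 3 (λ p q u → (p :+ q) :+ u := (u :+ p) :+ q) refl

      upper-block : ∀ {n e j} → suc ν₁ +ℕ n ≡ e → Range (suc ν₁) n j → ν₁ < j × j < e
      upper-block {j = j} ends (ν₁<j , j<) = ν₁<j , ≡.subst (j <_) ends j<

      -- G^ν(β) is defined because Π^λ_{1a} is.
      GDefined-new : L.ΠDefined → GDefined ν x′ β
      GDefined-new Π-def j r = nonzero-resp (Dy-low j r)
        (proj₂ (Π-def 1 a new-corner) j (proj₁ r) (ℕₚ.≤-<-trans (range≤ν₁ r) ν₁<a))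

      -- G^λ(t) = G^ν(x₁ + β + t) (t + x₁ + β)/(t + x₁): the factors with j > ν₁ telescope.
      G-new-corner : ∀ t → NonZero (t + x 1) → GDefined (a ∷ ν) x t →
                     G (a ∷ ν) x t ≈ G ν x′ ((x 1 + β) + t) * (((t + x 1) + β) * inv (t + x 1))
      G-new-corner t T≉0 G-def = begin
        prodFrom 1 a factor
          ≡⟨ ≡.cong (λ m → prodFrom 1 m factor) (≡.sym (ℕₚ.m+[n∸m]≡n ν₁≤a)) ⟩
        prodFrom 1 (ν₁ +ℕ n) factor                          ≈⟨ prodFrom-split 1 ν₁ n factor ⟩
        prodFrom 1 ν₁ factor * prodFrom (suc ν₁) n factor    ≈⟨ *-cong (G-low t) upper ⟩
        G ν x′ ((x 1 + β) + t) * ((T + β) * inv T)           ∎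
        where
        T = t + x 1
        n = a ∸ ν₁
        factor = λ j → 1# + y j * inv (C̃ (a ∷ ν) x j + t)
        S : ℕ → Carrier
        S j = T + Σ[ j ⋯ a ] y
        ends : suc ν₁ +ℕ n ≡ suc a
        ends = ≡.cong suc (ℕₚ.m+[n∸m]≡n ν₁≤a)
        denominator : ∀ j → Range (suc ν₁) n j → C̃ (a ∷ ν) x j + t ≈ S (suc j)
        denominator j r = let (ν₁<j , j<1+a) = upper-block ends r in C̃-high t ν₁<j (ℕₚ.≤-pred j<1+a)
        S-step : ∀ j → Range (suc ν₁) n j → S j ≈ y j + S (suc j)
        S-step j r = tail-step y T (ℕₚ.≤-pred (proj₂ (upper-block ends r)))
        S≉0 : ∀ j → Range (suc ν₁) n j → NonZero (S (suc j))
        S≉0 j r = nonzero-resp (denominator j r)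
          (G-def j (ℕₚ.≤-trans (s≤s z≤n) (proj₁ r) , proj₂ (upper-block ends r)))
        S-end : T ≈ S (suc ν₁ +ℕ n)
        S-end = begin
          T                      ≈⟨ sym (+-identityʳ T) ⟩
          T + 0#                 ≈⟨ +-cong refl (sym (Σ-empty y a)) ⟩
          S (suc a)              ≡⟨ ≡.cong S (≡.sym ends) ⟩
          S (suc ν₁ +ℕ n)        ∎
        upper : prodFrom (suc ν₁) n factor ≈ (T + β) * inv T
        upper = solve-linearʳ T≉0 (begin
          prodFrom (suc ν₁) n factor * T   ≈⟨ *-comm _ T ⟩
          T * prodFrom (suc ν₁) n factor
            ≈⟨ *-cong S-end (prodFrom-cong (suc ν₁) n (λ j r → +-cong refl (*-cong refl (inv-cong (denominator j r))))) ⟩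
          S (suc ν₁ +ℕ n) * prodFrom (suc ν₁) n (λ j → 1# + y j * inv (S (suc j)))
            ≈⟨ telescope y S n (suc ν₁) S-step S≉0 ⟩
          T + β                            ∎)

      -- Π^λ_{1a} = x₁ β G^ν(β): again the factors with j > ν₁ telescope.
      Π-new : L.ΠDefined → L.Π 1 a ≈ x 1 * (β * G ν x′ β)
      Π-new Π-def = begin
        ((x 1 * y a) * 1#) * prodFrom 1 (a ∸ 1) factor
          ≡⟨ ≡.cong (λ m → ((x 1 * y a) * 1#) * prodFrom 1 m factor) (≡.sym (ℕₚ.m+[n∸m]≡n ν₁≤a-1)) ⟩
        ((x 1 * y a) * 1#) * prodFrom 1 (ν₁ +ℕ n) factor
          ≈⟨ *-cong refl (prodFrom-split 1 ν₁ n factor) ⟩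
        ((x 1 * y a) * 1#) * (prodFrom 1 ν₁ factor * prodFrom (suc ν₁) n factor)
          ≈⟨ regroup _ _ _ _ ⟩
        x 1 * ((y a * prodFrom (suc ν₁) n factor) * prodFrom 1 ν₁ factor)
          ≈⟨ *-cong refl (*-cong upper lower) ⟩
        x 1 * (β * G ν x′ β) ∎
        where
        ν₁≤a-1 : ν₁ ≤ a ∸ 1
        ν₁≤a-1 = ℕₚ.∸-monoˡ-≤ 1 ν₁<a
        n = (a ∸ 1) ∸ ν₁
        factor = λ j → 1# + y j * inv (L.Dy 1 a j)
        S : ℕ → Carrier
        S j = Σ[ j ⋯ a ] y
        ends : suc ν₁ +ℕ n ≡ a
        ends = ≡.trans (≡.cong suc (ℕₚ.m+[n∸m]≡n ν₁≤a-1)) (ℕₚ.m+[n∸m]≡n (ℕₚ.≤-trans (s≤s z≤n) ν₁<a))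
        denominator : ∀ j → Range (suc ν₁) n j → L.Dy 1 a j ≈ S (suc j)
        denominator j r = let (ν₁<j , j<a) = upper-block ends r in Dy-high ν₁<j (ℕₚ.<⇒≤ j<a)
        S-step : ∀ j → Range (suc ν₁) n j → S j ≈ y j + S (suc j)
        S-step j r = reflexive (Σ-peel y (ℕₚ.<⇒≤ (proj₂ (upper-block ends r))))
        S≉0 : ∀ j → Range (suc ν₁) n j → NonZero (S (suc j))
        S≉0 j r = nonzero-resp (denominator j r)
          (proj₂ (Π-def 1 a new-corner) j (ℕₚ.≤-trans (s≤s z≤n) (proj₁ r)) (proj₂ (upper-block ends r)))
        S-end : y a ≈ S (suc ν₁ +ℕ n)
        S-end = begin
          y a                        ≈⟨ sym (+-identityʳ (y a)) ⟩
          y a + 0#                   ≈⟨ +-cong refl (sym (Σ-empty y a)) ⟩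
          y a + Σ[ suc a ⋯ a ] y     ≡⟨ ≡.sym (Σ-peel y ℕₚ.≤-refl) ⟩
          S a                        ≡⟨ ≡.cong S (≡.sym ends) ⟩
          S (suc ν₁ +ℕ n)            ∎
        upper : y a * prodFrom (suc ν₁) n factor ≈ β
        upper = begin
          y a * prodFrom (suc ν₁) n factor
            ≈⟨ *-cong S-end (prodFrom-cong (suc ν₁) n (λ j r → +-cong refl (*-cong refl (inv-cong (denominator j r))))) ⟩
          S (suc ν₁ +ℕ n) * prodFrom (suc ν₁) n (λ j → 1# + y j * inv (S (suc j)))
            ≈⟨ telescope y S n (suc ν₁) S-step S≉0 ⟩
          β ∎
        lower : prodFrom 1 ν₁ factor ≈ G ν x′ β
        lower = prodFrom-cong 1 ν₁ (λ j r → +-cong refl (*-cong refl (inv-cong (Dy-low j r))))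
        regroup : ∀ p q g w → ((p * q) * 1#) * (g * w) ≈ p * ((q * w) * g)
        regroup = solve 4 (λ p q g w → ((p :* q) :* con 1) :* (g :* w) := p :* ((q :* w) :* g)) refl

    module NoNewCorner (ν₁≡a : ν₁ ≡ a) where
      β≈0 : β ≈ 0#
      β≈0 = reflexive (≡.cong (λ n → sumFrom (suc ν₁) n y) (≡.trans (≡.cong (a ∸_) ν₁≡a) (ℕₚ.n∸n≡0 a)))

      ν-nonempty : ¬ (ν ≡ [])
      ν-nonempty ν≡[] with ≡.subst (1 ≤_) (≡.sym (≡.subst (λ μ → part μ 1 ≡ a) ν≡[] ν₁≡a)) (partition-head-pos ip)
      ... | ()

      Y-no-new-corner : Y (a ∷ ν) ≈ Y ν
      Y-no-new-corner = trans Y-first-row (trans (+-cong refl β≈0) (+-identityʳ _))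

      G-no-new-corner : ∀ t → G (a ∷ ν) x t ≈ G ν x′ ((x 1 + β) + t)
      G-no-new-corner t = trans
        (reflexive (≡.cong (λ n → prodFrom 1 n (λ j → 1# + y j * inv (C̃ (a ∷ ν) x j + t))) (≡.sym ν₁≡a)))
        (G-low t)

  module _ (λs : List ℕ) (x : ℕ → Carrier) where
    open Identities λs x y

    C+Defined : Carrier → Set ℓ
    C+Defined t = ∀ r s → IsCorner λs r s → NonZero (C r s + t)

    J-weight : Carrier → Carrier → ℕ → ℕ → Carrier
    J-weight α t r s = ((α + C r s) * inv (C r s)) * inv (C r s + (α + t))

    record SixIdentities : Set (c ⊔ ℓ) where
      field
        identity-a : cornerSum Π ≈ cellSum
        identity-b : BDefined → cornerSum (λ r s → inv (B r s) * Π r s) ≈ Σ[ 1 ⋯ ℓλ ] x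
        identity-c : CDefined → cornerSum (λ r s → inv (C r s) * Π r s) ≈ Y λs
        identity-d : ¬ (λs ≡ []) → BDefined → CDefined →
                     cornerSum (λ r s → inv (B r s * C r s) * Π r s) ≈ 1#
        identity-H : ∀ t → C+Defined t → GDefined λs x t →
                     cornerSum (λ r s → inv (C r s + t) * Π r s) + t * G λs x t ≈ Y λs + t
        identity-J : ∀ α t → CDefined → C+Defined (α + t) → GDefined λs x (α + t) →
                     cornerSum (λ r s → J-weight α t r s * Π r s) + t * G λs x (α + t) ≈ Y λs + t

  six-identities-[] : ∀ x → SixIdentities [] x
  six-identities-[] x = record
    { identity-a = refl
    ; identity-b = λ _ → refl
    ; identity-c = λ _ → refl
    ; identity-d = λ []≢[] → ⊥-elim ([]≢[] ≡.refl)
    ; identity-H = λ t _ _ → +-cong refl (*-identityʳ t)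
    ; identity-J = λ α t _ _ _ → +-cong refl (*-identityʳ t)
    }

  module Step (a : ℕ) (ν : List ℕ) (x : ℕ → Carrier) (ip : IsPartition (a ∷ ν))
              (Π-def : Identities.ΠDefined (a ∷ ν) x y)
              (IH : SixIdentities ν (λ k → x (suc k))) where
    open RowRemoval a ν x ip
    open SixIdentities IH

    module MovedCorner {r s : ℕ} (cn : IsCorner ν r s) where
      P : Carrier
      P = N.Π r s

      D : Carrier
      D = N.C r s + β

      D≉0 : NonZero D
      D≉0 = nonzero-resp (Dx-first cn)
        (proj₁ (Π-def (suc r) s (corner-down cn)) 1 (s≤s z≤n) (s≤s (corner-row-pos cn)))

      C-eq : L.C (suc r) s ≈ x 1 + D
      C-eq = C-shift cn

      Π-factor : L.Π (suc r) s ≈ P * (1# + x 1 * inv D)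
      Π-factor = trans (Π-shift cn) (*-cong refl (+-cong refl (*-cong refl (inv-cong (Dx-first cn)))))

      Π-expand : L.Π (suc r) s ≈ P + x 1 * (inv D * P)
      Π-expand = trans Π-factor (distribute P (x 1) (inv D))
        where
        distribute : ∀ p u i → p * (1# + u * i) ≈ p + u * (i * p)
        distribute = solve 3 (λ p u i → p :* (con 1 :+ u :* i) := p :+ u :* (i :* p)) refl

      Π-ratio : L.Π (suc r) s ≈ P * ((x 1 + D) * inv D)
      Π-ratio = trans Π-factor (*-cong refl (one-plus-fraction (x 1) D≉0))

      Π/C : NonZero (L.C (suc r) s) → inv (L.C (suc r) s) * L.Π (suc r) s ≈ inv D * P
      Π/C C≉0 = begin
        inv (L.C (suc r) s) * L.Π (suc r) s       ≈⟨ *-cong (inv-cong C-eq) Π-ratio ⟩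
        inv (x 1 + D) * (P * ((x 1 + D) * inv D)) ≈⟨ *-cong refl (regroup P (x 1 + D) (inv D)) ⟩
        inv (x 1 + D) * ((x 1 + D) * (inv D * P)) ≈⟨ cancelˡ (inv D * P) (nonzero-resp C-eq C≉0) ⟩
        inv D * P                                 ∎
        where
        regroup : ∀ p e i → p * (e * i) ≈ e * (i * p)
        regroup = solve 3 (λ p e i → p :* (e :* i) := e :* (i :* p)) refl

      Π/BC : NonZero (L.B (suc r) s) → NonZero (L.C (suc r) s) →
             inv (L.B (suc r) s * L.C (suc r) s) * L.Π (suc r) s ≈ inv (N.B r s) * (inv D * P)
      Π/BC B≉0 C≉0 = begin
        inv (L.B (suc r) s * L.C (suc r) s) * L.Π (suc r) s
          ≈⟨ *-cong (inv-* B≉0 C≉0) refl ⟩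
        (inv (L.B (suc r) s) * inv (L.C (suc r) s)) * L.Π (suc r) s
          ≈⟨ *-assoc _ _ _ ⟩
        inv (L.B (suc r) s) * (inv (L.C (suc r) s) * L.Π (suc r) s)
          ≈⟨ *-cong (reflexive (≡.cong inv (B-shift r s))) (Π/C C≉0) ⟩
        inv (N.B r s) * (inv D * P) ∎

      weighted-Π/C : NonZero (L.C (suc r) s) → ∀ u v →
                     ((u * inv (L.C (suc r) s)) * v) * L.Π (suc r) s ≈ ((u * inv D) * v) * P
      weighted-Π/C C≉0 u v = begin
        ((u * inv (L.C (suc r) s)) * v) * L.Π (suc r) s ≈⟨ pull (inv (L.C (suc r) s)) (L.Π (suc r) s) ⟩
        (u * v) * (inv (L.C (suc r) s) * L.Π (suc r) s) ≈⟨ *-cong refl (Π/C C≉0) ⟩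
        (u * v) * (inv D * P)                           ≈⟨ sym (pull (inv D) P) ⟩
        ((u * inv D) * v) * P                           ∎
        where
        pull : ∀ i p → ((u * i) * v) * p ≈ (u * v) * (i * p)
        pull = solve 4 (λ u v i p → ((u :* i) :* v) :* p := (u :* v) :* (i :* p)) refl u v

    -- Case ν₁ < a: the new corner (1, a) contributes x₁ β G^ν(β), which (H)
    -- for ν at t = β absorbs.
    module WithNewCorner (ν₁<a : ν₁ < a) where
      open NewCorner ν₁<a

      G₁ : Carrier
      G₁ = G ν x′ β

      Π-new′ : L.Π 1 a ≈ x 1 * (β * G₁)
      Π-new′ = Π-new Π-def

      h₁ : Carrier
      h₁ = CornerSum ν (λ r s → inv (N.C r s + β) * N.Π r s)

      H-at-β : h₁ + β * G₁ ≈ Y ν + β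
      H-at-β = identity-H β (λ r s cn → MovedCorner.D≉0 cn) (GDefined-new Π-def)

      -- (a): the new corner and the x₁-parts of the moved corners sum to x₁ Y^λ.
      identity-a′ : CornerSum (a ∷ ν) L.Π ≈ L.cellSum
      identity-a′ = begin
        CornerSum (a ∷ ν) L.Π
          ≈⟨ cornerSum-new-corner ip ν₁<a L.Π ⟩
        L.Π 1 a + CornerSum ν (λ r s → L.Π (suc r) s)
          ≈⟨ +-cong Π-new′ (cornerSum-cong ν (λ r s cn → MovedCorner.Π-expand cn)) ⟩
        x 1 * (β * G₁) + CornerSum ν (λ r s → N.Π r s + x 1 * (inv (N.C r s + β) * N.Π r s))
          ≈⟨ +-cong refl (trans (cornerSum-+ ν _ _) (+-cong identity-a (cornerSum-scale ν (x 1) _))) ⟩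
        x 1 * (β * G₁) + (N.cellSum + x 1 * h₁)   ≈⟨ regroup (x 1) β G₁ N.cellSum h₁ ⟩
        x 1 * (h₁ + β * G₁) + N.cellSum           ≈⟨ +-cong (*-cong refl (trans H-at-β (sym Y-first-row))) refl ⟩
        x 1 * Y (a ∷ ν) + N.cellSum               ≈⟨ sym cellSum-first-row ⟩
        L.cellSum                                 ∎
        where
        regroup : ∀ u b g c h → u * (b * g) + (c + u * h) ≈ u * (h + b * g) + c
        regroup = solve 5 (λ u b g c h → u :* (b :* g) :+ (c :+ u :* h) := u :* (h :+ b :* g) :+ c) refl

      -- (c): the new corner gives β G₁, the moved corners give h₁.
      identity-c′ : L.CDefined → CornerSum (a ∷ ν) (λ r s → inv (L.C r s) * L.Π r s) ≈ Y (a ∷ ν)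
      identity-c′ C-def = begin
        CornerSum (a ∷ ν) (λ r s → inv (L.C r s) * L.Π r s)
          ≈⟨ cornerSum-new-corner ip ν₁<a _ ⟩
        inv (L.C 1 a) * L.Π 1 a + CornerSum ν (λ r s → inv (L.C (suc r) s) * L.Π (suc r) s)
          ≈⟨ +-cong new-term (cornerSum-cong ν (λ r s cn → MovedCorner.Π/C cn (C-def (suc r) s (corner-down cn)))) ⟩
        β * G₁ + h₁   ≈⟨ +-comm _ _ ⟩
        h₁ + β * G₁   ≈⟨ H-at-β ⟩
        Y ν + β       ≈⟨ sym Y-first-row ⟩
        Y (a ∷ ν)     ∎
        where
        new-term : inv (L.C 1 a) * L.Π 1 a ≈ β * G₁
        new-term = trans (*-cong (inv-cong C-new) Π-new′)
                         (cancelˡ _ (nonzero-resp C-new (C-def 1 a new-corner)))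

      -- With B defined: B^ν + D = B^λ_{1a} =: W at every corner of ν, so that
      -- 1/(B^ν D) splits into partial fractions over W.
      module WithB (B-def : L.BDefined) where
        W : Carrier
        W = L.B 1 a

        W≉0 : NonZero W
        W≉0 = B-def 1 a new-corner

        B-def-ν : N.BDefined
        B-def-ν = BDefined-tail B-def

        B+D≈W : ∀ {r s} (cn : IsCorner ν r s) → N.B r s + MovedCorner.D cn ≈ W
        B+D≈W {r} {s} cn = begin
          N.B r s + (N.C r s + β)         ≈⟨ sym (+-assoc _ _ _) ⟩
          (N.B r s + N.C r s) + β         ≈⟨ +-cong (B+C x′ ν-partition cn) refl ⟩
          (Σ[ 1 ⋯ N.ℓλ ] x′ + Y ν) + β   ≈⟨ +-assoc _ _ _ ⟩
          Σ[ 1 ⋯ N.ℓλ ] x′ + (Y ν + β)   ≈⟨ sym B-new ⟩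
          W                                ∎

        b-sum : Carrier
        b-sum = CornerSum ν (λ r s → inv (N.B r s) * N.Π r s)

        BD-sum : CornerSum ν (λ r s → inv (N.B r s) * (inv (N.C r s + β) * N.Π r s)) ≈ inv W * (b-sum + h₁)
        BD-sum = trans (cornerSum-cong ν split)
                       (trans (cornerSum-scale ν (inv W) _) (*-cong refl (cornerSum-+ ν _ _)))
          where
          split : ∀ r s → IsCorner ν r s → inv (N.B r s) * (inv (N.C r s + β) * N.Π r s)
                    ≈ inv W * (inv (N.B r s) * N.Π r s + inv (N.C r s + β) * N.Π r s)
          split r s cn = begin
            inv (N.B r s) * (inv (N.C r s + β) * N.Π r s)            ≈⟨ sym (*-assoc _ _ _) ⟩
            (inv (N.B r s) * inv (N.C r s + β)) * N.Π r s
              ≈⟨ *-cong (partial-fractions (B-def-ν r s cn) (MovedCorner.D≉0 cn) W≉0 (B+D≈W cn)) refl ⟩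
            (inv W * (inv (N.B r s) + inv (N.C r s + β))) * N.Π r s  ≈⟨ *-assoc _ _ _ ⟩
            inv W * ((inv (N.B r s) + inv (N.C r s + β)) * N.Π r s)  ≈⟨ *-cong refl (distribʳ _ _ _) ⟩
            inv W * (inv (N.B r s) * N.Π r s + inv (N.C r s + β) * N.Π r s) ∎

        b-sum+H : b-sum + (h₁ + β * G₁) ≈ W
        b-sum+H = trans (+-cong (identity-b B-def-ν) H-at-β) (sym B-new)

        identity-b′ : CornerSum (a ∷ ν) (λ r s → inv (L.B r s) * L.Π r s) ≈ Σ[ 1 ⋯ L.ℓλ ] x
        identity-b′ = begin
          CornerSum (a ∷ ν) (λ r s → inv (L.B r s) * L.Π r s)
            ≈⟨ cornerSum-new-corner ip ν₁<a _ ⟩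
          inv W * L.Π 1 a + CornerSum ν (λ r s → inv (L.B (suc r) s) * L.Π (suc r) s)
            ≈⟨ +-cong (*-cong refl Π-new′) (cornerSum-cong ν shifted) ⟩
          inv W * (x 1 * (β * G₁))
            + CornerSum ν (λ r s → inv (N.B r s) * N.Π r s + x 1 * (inv (N.B r s) * (inv (N.C r s + β) * N.Π r s)))
            ≈⟨ +-cong refl (trans (cornerSum-+ ν _ _)
                 (+-cong refl (trans (cornerSum-scale ν (x 1) _) (*-cong refl BD-sum)))) ⟩
          inv W * (x 1 * (β * G₁)) + (b-sum + x 1 * (inv W * (b-sum + h₁)))
            ≈⟨ regroup (inv W) (x 1) β G₁ b-sum h₁ ⟩
          b-sum + x 1 * (inv W * (b-sum + (h₁ + β * G₁)))
            ≈⟨ +-cong (identity-b B-def-ν) (*-cong refl (*-cong refl b-sum+H)) ⟩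
          Σ[ 1 ⋯ N.ℓλ ] x′ + x 1 * (inv W * W)
            ≈⟨ +-cong refl (trans (*-cong refl (inverseˡ W≉0)) (*-identityʳ _)) ⟩
          Σ[ 1 ⋯ N.ℓλ ] x′ + x 1   ≈⟨ +-comm _ _ ⟩
          x 1 + Σ[ 1 ⋯ N.ℓλ ] x′   ≡⟨ ≡.sym X-first-row ⟩
          Σ[ 1 ⋯ L.ℓλ ] x          ∎
          where
          shifted : ∀ r s → IsCorner ν r s → inv (L.B (suc r) s) * L.Π (suc r) s
                      ≈ inv (N.B r s) * N.Π r s + x 1 * (inv (N.B r s) * (inv (N.C r s + β) * N.Π r s))
          shifted r s cn = trans (*-cong (reflexive (≡.cong inv (B-shift r s))) (MovedCorner.Π-expand cn))
                                 (distribute _ _ _ _)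
            where
            distribute : ∀ b p u d → b * (p + u * d) ≈ b * p + u * (b * d)
            distribute = solve 4 (λ b p u d → b :* (p :+ u :* d) := b :* p :+ u :* (b :* d)) refl
          regroup : ∀ w u b g s h →
                    w * (u * (b * g)) + (s + u * (w * (s + h))) ≈ s + u * (w * (s + (h + b * g)))
          regroup = solve 6 (λ w u b g s h →
            w :* (u :* (b :* g)) :+ (s :+ u :* (w :* (s :+ h))) := s :+ u :* (w :* (s :+ (h :+ b :* g)))) refl

        identity-d′ : L.CDefined → CornerSum (a ∷ ν) (λ r s → inv (L.B r s * L.C r s) * L.Π r s) ≈ 1#
        identity-d′ C-def = begin
          CornerSum (a ∷ ν) (λ r s → inv (L.B r s * L.C r s) * L.Π r s)
            ≈⟨ cornerSum-new-corner ip ν₁<a _ ⟩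
          inv (W * L.C 1 a) * L.Π 1 a
            + CornerSum ν (λ r s → inv (L.B (suc r) s * L.C (suc r) s) * L.Π (suc r) s)
            ≈⟨ +-cong new-term (cornerSum-cong ν (λ r s cn →
                 MovedCorner.Π/BC cn (B-def (suc r) s (corner-down cn)) (C-def (suc r) s (corner-down cn)))) ⟩
          inv W * (β * G₁) + CornerSum ν (λ r s → inv (N.B r s) * (inv (N.C r s + β) * N.Π r s))
            ≈⟨ +-cong refl BD-sum ⟩
          inv W * (β * G₁) + inv W * (b-sum + h₁)   ≈⟨ regroup (inv W) β G₁ b-sum h₁ ⟩
          inv W * (b-sum + (h₁ + β * G₁))           ≈⟨ *-cong refl b-sum+H ⟩
          inv W * W                                 ≈⟨ inverseˡ W≉0 ⟩
          1#                                        ∎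
          where
          new-term : inv (W * L.C 1 a) * L.Π 1 a ≈ inv W * (β * G₁)
          new-term = begin
            inv (W * L.C 1 a) * L.Π 1 a
              ≈⟨ *-cong (trans (inv-* W≉0 (C-def 1 a new-corner)) (*-cong refl (inv-cong C-new))) Π-new′ ⟩
            (inv W * inv (x 1)) * (x 1 * (β * G₁)) ≈⟨ *-assoc _ _ _ ⟩
            inv W * (inv (x 1) * (x 1 * (β * G₁))) ≈⟨ *-cong refl (cancelˡ _ (nonzero-resp C-new (C-def 1 a new-corner))) ⟩
            inv W * (β * G₁)                       ∎
          regroup : ∀ w b g s h → w * (b * g) + w * (s + h) ≈ w * (s + (h + b * g))
          regroup = solve 5 (λ w b g s h → w :* (b :* g) :+ w :* (s :+ h) := w :* (s :+ (h :+ b :* g))) refl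

      -- With K = A + t, the new corner contributes
      -- (A/K) β G₁ and a moved corner ((A + D)/D) Π^ν/(D + K), which splits as
      -- (1/K)(A Π^ν/D + t Π^ν/(D + K)); then (H) for ν at β and at β + K,
      -- weighted by A/K and t/K, add up to Y^λ + t.
      module Core (A t : Carrier) (K≉0 : NonZero (A + t))
                  (M≉0 : C+Defined ν x′ (β + (A + t))) (G-def : GDefined ν x′ (β + (A + t))) where
        K : Carrier
        K = A + t

        G₂ : Carrier
        G₂ = G ν x′ (β + K)

        h₂ : Carrier
        h₂ = CornerSum ν (λ r s → inv (N.C r s + (β + K)) * N.Π r s)

        H-at-β+K : h₂ + (β + K) * G₂ ≈ Y ν + (β + K)
        H-at-β+K = identity-H (β + K) M≉0 G-def

        moved-weight : ℕ → ℕ → Carrier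
        moved-weight r s = ((A + (N.C r s + β)) * inv (N.C r s + β)) * inv (N.C r s + (β + K))

        moved-sum : CornerSum ν (λ r s → moved-weight r s * N.Π r s) ≈ inv K * (A * h₁ + t * h₂)
        moved-sum = trans (cornerSum-cong ν split) (trans (cornerSum-scale ν (inv K) _)
          (*-cong refl (trans (cornerSum-+ ν _ _) (+-cong (cornerSum-scale ν A _) (cornerSum-scale ν t _)))))
          where
          distribute : ∀ k a d b m p → (k * (a * d + b * m)) * p ≈ k * (a * (d * p) + b * (m * p))
          distribute = solve 6 (λ k a d b m p →
            (k :* (a :* d :+ b :* m)) :* p := k :* (a :* (d :* p) :+ b :* (m :* p))) refl
          split : ∀ r s → IsCorner ν r s → moved-weight r s * N.Π r s
                    ≈ inv K * (A * (inv (N.C r s + β) * N.Π r s) + t * (inv (N.C r s + (β + K)) * N.Π r s))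
          split r s cn = trans
            (*-cong (split-fraction (MovedCorner.D≉0 cn) K≉0 (M≉0 r s cn) (sym (+-assoc _ _ _)) refl) refl)
            (distribute _ _ _ _ _ _)

        -- Two instances of (H) for ν, averaged with weights A/K and t/K.
        average : (inv K * (A * (β * G₁)) + inv K * (A * h₁ + t * h₂)) + t * (G₂ * ((K + β) * inv K))
                  ≈ (Y ν + β) + t
        average = begin
          (inv K * (A * (β * G₁)) + inv K * (A * h₁ + t * h₂)) + t * (G₂ * ((K + β) * inv K))
            ≈⟨ collect (inv K) A β G₁ h₁ t h₂ G₂ K ⟩
          inv K * (A * (h₁ + β * G₁) + t * (h₂ + (β + K) * G₂))
            ≈⟨ *-cong refl (+-cong (*-cong refl H-at-β) (*-cong refl H-at-β+K)) ⟩
          inv K * (A * (Y ν + β) + t * (Y ν + (β + K)))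
            ≈⟨ *-cong refl (factor A t (Y ν) β) ⟩
          inv K * (K * ((Y ν + β) + t))
            ≈⟨ cancelˡ _ K≉0 ⟩
          (Y ν + β) + t ∎
          where
          collect : ∀ i a b g h t h′ g′ k →
            (i * (a * (b * g)) + i * (a * h + t * h′)) + t * (g′ * ((k + b) * i))
              ≈ i * (a * (h + b * g) + t * (h′ + (b + k) * g′))
          collect = solve 9 (λ i a b g h t h′ g′ k →
            (i :* (a :* (b :* g)) :+ i :* (a :* h :+ t :* h′)) :+ t :* (g′ :* ((k :+ b) :* i))
              := i :* (a :* (h :+ b :* g) :+ t :* (h′ :+ (b :+ k) :* g′))) refl
          factor : ∀ a t u b → a * (u + b) + t * (u + (b + (a + t))) ≈ (a + t) * ((u + b) + t)
          factor = solve 4 (λ a t u b →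
            a :* (u :+ b) :+ t :* (u :+ (b :+ (a :+ t))) := (a :+ t) :* ((u :+ b) :+ t)) refl

        conclude : ∀ (w : ℕ → ℕ → Carrier) {Gλ} →
          w 1 a * L.Π 1 a ≈ inv K * (A * (β * G₁)) →
          (∀ r s → IsCorner ν r s → w (suc r) s * L.Π (suc r) s ≈ moved-weight r s * N.Π r s) →
          Gλ ≈ G₂ * ((K + β) * inv K) →
          CornerSum (a ∷ ν) (λ r s → w r s * L.Π r s) + t * Gλ ≈ Y (a ∷ ν) + t
        conclude w {Gλ} new moved G-eq = begin
          CornerSum (a ∷ ν) (λ r s → w r s * L.Π r s) + t * Gλ
            ≈⟨ +-cong (cornerSum-new-corner ip ν₁<a _) (*-cong refl G-eq) ⟩
          (w 1 a * L.Π 1 a + CornerSum ν (λ r s → w (suc r) s * L.Π (suc r) s)) + t * (G₂ * ((K + β) * inv K))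
            ≈⟨ +-cong (+-cong new (trans (cornerSum-cong ν moved) moved-sum)) refl ⟩
          (inv K * (A * (β * G₁)) + inv K * (A * h₁ + t * h₂)) + t * (G₂ * ((K + β) * inv K))
            ≈⟨ average ⟩
          (Y ν + β) + t    ≈⟨ +-cong (sym Y-first-row) refl ⟩
          Y (a ∷ ν) + t    ∎

      -- (H) for λ at t: A = x₁; (J) for λ at (α, t): A = α + x₁.
      identity-H′ : ∀ t → C+Defined (a ∷ ν) x t → GDefined (a ∷ ν) x t →
        CornerSum (a ∷ ν) (λ r s → inv (L.C r s + t) * L.Π r s) + t * G (a ∷ ν) x t ≈ Y (a ∷ ν) + t
      identity-H′ t C+def G-def = conclude (λ r s → inv (L.C r s + t)) new-term moved G-eq
        where
        swap : ∀ u b v → (u + b) + v ≈ b + (u + v)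
        swap = solve 3 (λ u b v → (u :+ b) :+ v := b :+ (u :+ v)) refl
        M-regroup : ∀ u c b v → (u + (c + b)) + v ≈ c + (b + (u + v))
        M-regroup = solve 4 (λ u c b v → (u :+ (c :+ b)) :+ v := c :+ (b :+ (u :+ v))) refl
        K≉0 : NonZero (x 1 + t)
        K≉0 = nonzero-resp (+-cong C-new refl) (C+def 1 a new-corner)
        M-eq : ∀ {r s} (cn : IsCorner ν r s) → L.C (suc r) s + t ≈ N.C r s + (β + (x 1 + t))
        M-eq cn = trans (+-cong (MovedCorner.C-eq cn) refl) (M-regroup _ _ _ _)
        open Core (x 1) t K≉0 (λ r s cn → nonzero-resp (M-eq cn) (C+def (suc r) s (corner-down cn)))
                  (GDefined-resp ν x′ (swap _ _ _) (GDefined-tail t G-def))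
        new-term : inv (L.C 1 a + t) * L.Π 1 a ≈ inv K * (x 1 * (β * G₁))
        new-term = *-cong (inv-cong (+-cong C-new refl)) Π-new′
        moved : ∀ r s → IsCorner ν r s → inv (L.C (suc r) s + t) * L.Π (suc r) s ≈ moved-weight r s * N.Π r s
        moved r s cn = trans (*-cong (inv-cong (M-eq cn)) (MovedCorner.Π-ratio cn)) (rotate _ _ _)
          where
          rotate : ∀ m p q → m * (p * q) ≈ (q * m) * p
          rotate = solve 3 (λ m p q → m :* (p :* q) := (q :* m) :* p) refl
        G-eq : G (a ∷ ν) x t ≈ G₂ * ((K + β) * inv K)
        G-eq = trans (G-new-corner t (nonzero-resp (+-comm _ _) K≉0) G-def)
          (*-cong (G-cong ν x′ (swap _ _ _)) (*-cong (+-cong (+-comm _ _) refl) (inv-cong (+-comm _ _))))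

      identity-J′ : ∀ α t → L.CDefined → C+Defined (a ∷ ν) x (α + t) → GDefined (a ∷ ν) x (α + t) →
        CornerSum (a ∷ ν) (λ r s → J-weight (a ∷ ν) x α t r s * L.Π r s) + t * G (a ∷ ν) x (α + t)
          ≈ Y (a ∷ ν) + t
      identity-J′ α t C-def C+def G-def = conclude (J-weight (a ∷ ν) x α t) new-term moved G-eq
        where
        x₁-in : ∀ u v w → u + (v + w) ≈ (v + u) + w
        x₁-in = solve 3 (λ u v w → u :+ (v :+ w) := (v :+ u) :+ w) refl
        M-regroup : ∀ u c b v w → (u + (c + b)) + (v + w) ≈ c + (b + ((v + u) + w))
        M-regroup = solve 5 (λ u c b v w → (u :+ (c :+ b)) :+ (v :+ w) := c :+ (b :+ ((v :+ u) :+ w))) refl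
        G-regroup : ∀ u b v w → (u + b) + (v + w) ≈ b + ((v + u) + w)
        G-regroup = solve 4 (λ u b v w → (u :+ b) :+ (v :+ w) := b :+ ((v :+ u) :+ w)) refl
        K-regroup : ∀ v w u → (v + w) + u ≈ (v + u) + w
        K-regroup = solve 3 (λ v w u → (v :+ w) :+ u := (v :+ u) :+ w) refl
        K-eq : L.C 1 a + (α + t) ≈ (α + x 1) + t
        K-eq = trans (+-cong C-new refl) (x₁-in _ _ _)
        M-eq : ∀ {r s} (cn : IsCorner ν r s) → L.C (suc r) s + (α + t) ≈ N.C r s + (β + ((α + x 1) + t))
        M-eq cn = trans (+-cong (MovedCorner.C-eq cn) refl) (M-regroup _ _ _ _ _)
        K≉0 : NonZero ((α + x 1) + t)
        K≉0 = nonzero-resp K-eq (C+def 1 a new-corner)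
        open Core (α + x 1) t K≉0
                  (λ r s cn → nonzero-resp (M-eq cn) (C+def (suc r) s (corner-down cn)))
                  (GDefined-resp ν x′ (G-regroup _ _ _ _) (GDefined-tail (α + t) G-def))
        x₁≉0 : NonZero (x 1)
        x₁≉0 = nonzero-resp C-new (C-def 1 a new-corner)
        new-term : J-weight (a ∷ ν) x α t 1 a * L.Π 1 a ≈ inv K * ((α + x 1) * (β * G₁))
        new-term = begin
          (((α + L.C 1 a) * inv (L.C 1 a)) * inv (L.C 1 a + (α + t))) * L.Π 1 a
            ≈⟨ *-cong (*-cong (*-cong (+-cong refl C-new) (inv-cong C-new)) (inv-cong K-eq)) Π-new′ ⟩
          (((α + x 1) * inv (x 1)) * inv K) * (x 1 * (β * G₁)) ≈⟨ regroup _ _ _ _ _ ⟩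
          inv (x 1) * (x 1 * (inv K * ((α + x 1) * (β * G₁)))) ≈⟨ cancelˡ _ x₁≉0 ⟩
          inv K * ((α + x 1) * (β * G₁))                     ∎
          where
          regroup : ∀ u i k v w → ((u * i) * k) * (v * w) ≈ i * (v * (k * (u * w)))
          regroup = solve 5 (λ u i k v w → ((u :* i) :* k) :* (v :* w) := i :* (v :* (k :* (u :* w)))) refl
        moved : ∀ r s → IsCorner ν r s → J-weight (a ∷ ν) x α t (suc r) s * L.Π (suc r) s ≈ moved-weight r s * N.Π r s
        moved r s cn = trans
          (MovedCorner.weighted-Π/C cn (C-def (suc r) s (corner-down cn)) _ _)
          (*-cong (*-cong (*-cong (trans (+-cong refl (MovedCorner.C-eq cn)) (sym (+-assoc _ _ _))) refl)
                          (inv-cong (M-eq cn))) refl)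
        G-eq : G (a ∷ ν) x (α + t) ≈ G₂ * ((K + β) * inv K)
        G-eq = trans (G-new-corner (α + t) (nonzero-resp (sym (K-regroup _ _ _)) K≉0) G-def)
          (*-cong (G-cong ν x′ (G-regroup _ _ _ _))
                  (*-cong (+-cong (K-regroup _ _ _) refl) (inv-cong (K-regroup _ _ _))))

    -- Case ν₁ = a: there is no new corner and β = 0, so D = C^ν and
    -- C^λ = x₁ + C^ν; (H) and (J) for λ become (J) for ν.
    module WithoutNewCorner (ν₁≡a : ν₁ ≡ a) where
      open NoNewCorner ν₁≡a

      D≈C : ∀ {r s} (cn : IsCorner ν r s) → MovedCorner.D cn ≈ N.C r s
      D≈C cn = trans (+-cong refl β≈0) (+-identityʳ _)

      C-def-ν : N.CDefined
      C-def-ν r s cn = nonzero-resp (D≈C cn) (MovedCorner.D≉0 cn)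

      C-eq : ∀ {r s} (cn : IsCorner ν r s) → L.C (suc r) s ≈ x 1 + N.C r s
      C-eq cn = trans (MovedCorner.C-eq cn) (+-cong refl (D≈C cn))

      BC-moved : ∀ {r s} (cn : IsCorner ν r s) → N.BDefined →
                 inv (N.B r s) * (inv (MovedCorner.D cn) * N.Π r s) ≈ inv (N.B r s * N.C r s) * N.Π r s
      BC-moved {r} {s} cn B-def-ν = begin
        inv (N.B r s) * (inv (MovedCorner.D cn) * N.Π r s)  ≈⟨ sym (*-assoc _ _ _) ⟩
        (inv (N.B r s) * inv (MovedCorner.D cn)) * N.Π r s  ≈⟨ *-cong (*-cong refl (inv-cong (D≈C cn))) refl ⟩
        (inv (N.B r s) * inv (N.C r s)) * N.Π r s       ≈⟨ *-cong (sym (inv-* (B-def-ν r s cn) (C-def-ν r s cn))) refl ⟩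
        inv (N.B r s * N.C r s) * N.Π r s               ∎

      -- (a)–(d) for λ follow from (a)–(d) for ν, since Π^λ = Π^ν (1 + x₁/C^ν).
      identity-a′ : CornerSum (a ∷ ν) L.Π ≈ L.cellSum
      identity-a′ = begin
        CornerSum (a ∷ ν) L.Π                   ≈⟨ cornerSum-no-new-corner ip ν₁≡a L.Π ⟩
        CornerSum ν (λ r s → L.Π (suc r) s)     ≈⟨ cornerSum-cong ν moved ⟩
        CornerSum ν (λ r s → N.Π r s + x 1 * (inv (N.C r s) * N.Π r s))
          ≈⟨ trans (cornerSum-+ ν _ _)
               (+-cong identity-a (trans (cornerSum-scale ν (x 1) _) (*-cong refl (identity-c C-def-ν)))) ⟩
        N.cellSum + x 1 * Y ν                   ≈⟨ +-comm _ _ ⟩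
        x 1 * Y ν + N.cellSum                   ≈⟨ +-cong (*-cong refl (sym Y-no-new-corner)) refl ⟩
        x 1 * Y (a ∷ ν) + N.cellSum             ≈⟨ sym cellSum-first-row ⟩
        L.cellSum                               ∎
        where
        moved : ∀ r s → IsCorner ν r s → L.Π (suc r) s ≈ N.Π r s + x 1 * (inv (N.C r s) * N.Π r s)
        moved r s cn = trans (MovedCorner.Π-expand cn) (+-cong refl (*-cong refl (*-cong (inv-cong (D≈C cn)) refl)))

      identity-b′ : L.BDefined → CornerSum (a ∷ ν) (λ r s → inv (L.B r s) * L.Π r s) ≈ Σ[ 1 ⋯ L.ℓλ ] x
      identity-b′ B-def = begin
        CornerSum (a ∷ ν) (λ r s → inv (L.B r s) * L.Π r s)
          ≈⟨ trans (cornerSum-no-new-corner ip ν₁≡a _) (cornerSum-cong ν moved) ⟩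
        CornerSum ν (λ r s → inv (N.B r s) * N.Π r s + x 1 * (inv (N.B r s * N.C r s) * N.Π r s))
          ≈⟨ trans (cornerSum-+ ν _ _) (+-cong (identity-b B-def-ν)
               (trans (cornerSum-scale ν (x 1) _) (*-cong refl (identity-d ν-nonempty B-def-ν C-def-ν)))) ⟩
        Σ[ 1 ⋯ N.ℓλ ] x′ + x 1 * 1#   ≈⟨ trans (+-cong refl (*-identityʳ _)) (+-comm _ _) ⟩
        x 1 + Σ[ 1 ⋯ N.ℓλ ] x′        ≡⟨ ≡.sym X-first-row ⟩
        Σ[ 1 ⋯ L.ℓλ ] x               ∎
        where
        B-def-ν = BDefined-tail B-def
        distribute : ∀ b p u d → b * (p + u * d) ≈ b * p + u * (b * d)
        distribute = solve 4 (λ b p u d → b :* (p :+ u :* d) := b :* p :+ u :* (b :* d)) refl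
        moved : ∀ r s → IsCorner ν r s → inv (L.B (suc r) s) * L.Π (suc r) s
                  ≈ inv (N.B r s) * N.Π r s + x 1 * (inv (N.B r s * N.C r s) * N.Π r s)
        moved r s cn = trans (*-cong (reflexive (≡.cong inv (B-shift r s))) (MovedCorner.Π-expand cn))
          (trans (distribute _ _ _ _) (+-cong refl (*-cong refl (BC-moved cn B-def-ν))))

      identity-c′ : L.CDefined → CornerSum (a ∷ ν) (λ r s → inv (L.C r s) * L.Π r s) ≈ Y (a ∷ ν)
      identity-c′ C-def = begin
        CornerSum (a ∷ ν) (λ r s → inv (L.C r s) * L.Π r s)
          ≈⟨ trans (cornerSum-no-new-corner ip ν₁≡a _) (cornerSum-cong ν moved) ⟩
        CornerSum ν (λ r s → inv (N.C r s) * N.Π r s)   ≈⟨ identity-c C-def-ν ⟩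
        Y ν                                             ≈⟨ sym Y-no-new-corner ⟩
        Y (a ∷ ν)                                       ∎
        where
        moved : ∀ r s → IsCorner ν r s → inv (L.C (suc r) s) * L.Π (suc r) s ≈ inv (N.C r s) * N.Π r s
        moved r s cn = trans (MovedCorner.Π/C cn (C-def (suc r) s (corner-down cn))) (*-cong (inv-cong (D≈C cn)) refl)

      identity-d′ : L.BDefined → L.CDefined →
                    CornerSum (a ∷ ν) (λ r s → inv (L.B r s * L.C r s) * L.Π r s) ≈ 1#
      identity-d′ B-def C-def = trans (cornerSum-no-new-corner ip ν₁≡a _)
        (trans (cornerSum-cong ν moved) (identity-d ν-nonempty (BDefined-tail B-def) C-def-ν))
        where
        moved : ∀ r s → IsCorner ν r s →
                inv (L.B (suc r) s * L.C (suc r) s) * L.Π (suc r) s ≈ inv (N.B r s * N.C r s) * N.Π r s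
        moved r s cn = trans
          (MovedCorner.Π/BC cn (B-def (suc r) s (corner-down cn)) (C-def (suc r) s (corner-down cn)))
          (BC-moved cn (BDefined-tail B-def))

      via-J : ∀ α′ t (w : ℕ → ℕ → Carrier) {u} → C+Defined ν x′ (α′ + t) → GDefined ν x′ (α′ + t) →
              (∀ r s → IsCorner ν r s → w (suc r) s * L.Π (suc r) s ≈ J-weight ν x′ α′ t r s * N.Π r s) →
              G (a ∷ ν) x u ≈ G ν x′ (α′ + t) →
              CornerSum (a ∷ ν) (λ r s → w r s * L.Π r s) + t * G (a ∷ ν) x u ≈ Y (a ∷ ν) + t
      via-J α′ t w {u} C+def G-def moved G-eq = begin
        CornerSum (a ∷ ν) (λ r s → w r s * L.Π r s) + t * G (a ∷ ν) x u
          ≈⟨ +-cong (trans (cornerSum-no-new-corner ip ν₁≡a _) (cornerSum-cong ν moved)) (*-cong refl G-eq) ⟩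
        CornerSum ν (λ r s → J-weight ν x′ α′ t r s * N.Π r s) + t * G ν x′ (α′ + t)
          ≈⟨ identity-J α′ t C-def-ν C+def G-def ⟩
        Y ν + t          ≈⟨ +-cong (sym Y-no-new-corner) refl ⟩
        Y (a ∷ ν) + t    ∎

      -- (H) for λ at t is (J) for ν at (x₁, t); (J) for λ at (α, t) is (J) for ν at (α + x₁, t).
      identity-H′ : ∀ t → C+Defined (a ∷ ν) x t → GDefined (a ∷ ν) x t →
        CornerSum (a ∷ ν) (λ r s → inv (L.C r s + t) * L.Π r s) + t * G (a ∷ ν) x t ≈ Y (a ∷ ν) + t
      identity-H′ t C+def G-def = via-J (x 1) t (λ r s → inv (L.C r s + t))
        (λ r s cn → nonzero-resp (M-eq cn) (C+def (suc r) s (corner-down cn)))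
        (GDefined-resp ν x′ drop-β (GDefined-tail t G-def)) moved (trans (G-no-new-corner t) (G-cong ν x′ drop-β))
        where
        drop-β : (x 1 + β) + t ≈ x 1 + t
        drop-β = +-cong (trans (+-cong refl β≈0) (+-identityʳ _)) refl
        M-regroup : ∀ u c v → (u + c) + v ≈ c + (u + v)
        M-regroup = solve 3 (λ u c v → (u :+ c) :+ v := c :+ (u :+ v)) refl
        M-eq : ∀ {r s} (cn : IsCorner ν r s) → L.C (suc r) s + t ≈ N.C r s + (x 1 + t)
        M-eq cn = trans (+-cong (C-eq cn) refl) (M-regroup _ _ _)
        rotate : ∀ m p q → m * (p * q) ≈ (q * m) * p
        rotate = solve 3 (λ m p q → m :* (p :* q) := (q :* m) :* p) refl
        moved : ∀ r s → IsCorner ν r s → inv (L.C (suc r) s + t) * L.Π (suc r) s ≈ J-weight ν x′ (x 1) t r s * N.Π r s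
        moved r s cn = trans (*-cong (inv-cong (M-eq cn)) (MovedCorner.Π-ratio cn))
          (trans (rotate _ _ _) (*-cong (*-cong (*-cong (+-cong refl (D≈C cn)) (inv-cong (D≈C cn))) refl) refl))

      identity-J′ : ∀ α t → L.CDefined → C+Defined (a ∷ ν) x (α + t) → GDefined (a ∷ ν) x (α + t) →
        CornerSum (a ∷ ν) (λ r s → J-weight (a ∷ ν) x α t r s * L.Π r s) + t * G (a ∷ ν) x (α + t)
          ≈ Y (a ∷ ν) + t
      identity-J′ α t C-def C+def G-def = via-J (α + x 1) t (J-weight (a ∷ ν) x α t)
        (λ r s cn → nonzero-resp (M-eq cn) (C+def (suc r) s (corner-down cn)))
        (GDefined-resp ν x′ drop-β (GDefined-tail (α + t) G-def)) moved
        (trans (G-no-new-corner (α + t)) (G-cong ν x′ drop-β))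
        where
        x₁-in : ∀ u v w → u + (v + w) ≈ (v + u) + w
        x₁-in = solve 3 (λ u v w → u :+ (v :+ w) := (v :+ u) :+ w) refl
        drop-β : (x 1 + β) + (α + t) ≈ (α + x 1) + t
        drop-β = trans (+-cong (trans (+-cong refl β≈0) (+-identityʳ _)) refl) (x₁-in _ _ _)
        M-regroup : ∀ u c v w → (u + c) + (v + w) ≈ c + ((v + u) + w)
        M-regroup = solve 4 (λ u c v w → (u :+ c) :+ (v :+ w) := c :+ ((v :+ u) :+ w)) refl
        M-eq : ∀ {r s} (cn : IsCorner ν r s) → L.C (suc r) s + (α + t) ≈ N.C r s + ((α + x 1) + t)
        M-eq cn = trans (+-cong (C-eq cn) refl) (M-regroup _ _ _ _)
        moved : ∀ r s → IsCorner ν r s →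
                J-weight (a ∷ ν) x α t (suc r) s * L.Π (suc r) s ≈ J-weight ν x′ (α + x 1) t r s * N.Π r s
        moved r s cn = trans (MovedCorner.weighted-Π/C cn (C-def (suc r) s (corner-down cn)) _ _)
          (*-cong (*-cong (*-cong (trans (+-cong refl (C-eq cn)) (sym (+-assoc _ _ _))) (inv-cong (D≈C cn)))
                          (inv-cong (M-eq cn))) refl)

    step : SixIdentities (a ∷ ν) x
    step with ℕₚ.m≤n⇒m<n∨m≡n ν₁≤a
    ... | inj₁ ν₁<a = record
      { identity-a = identity-a′
      ; identity-b = WithB.identity-b′
      ; identity-c = identity-c′
      ; identity-d = λ _ B-def → WithB.identity-d′ B-def
      ; identity-H = identity-H′
      ; identity-J = identity-J′
      }
      where open WithNewCorner ν₁<a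
    ... | inj₂ ν₁≡a = record
      { identity-a = identity-a′
      ; identity-b = identity-b′
      ; identity-c = identity-c′
      ; identity-d = λ _ → identity-d′
      ; identity-H = identity-H′
      ; identity-J = identity-J′
      }
      where open WithoutNewCorner ν₁≡a

  six-identities : ∀ λs x → IsPartition λs → Identities.ΠDefined λs x y → SixIdentities λs x
  six-identities []      x _  _     = six-identities-[] x
  six-identities (a ∷ ν) x ip Π-def = Step.step a ν x ip Π-def
    (six-identities ν (λ k → x (suc k)) (partition-tail ip) (RowRemoval.ΠDefined-tail a ν x ip Π-def))

theorem3p1 : ∀ {c ℓ : Level} (F : Field c ℓ) (λs : List ℕ) →
    IsPartition λs → ¬ (λs ≡ []) → (x y : ℕ → Field.Carrier F) →
    let open Field F
        open FieldDefs F
        open Identities λs x y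
    in ΠDefined →
       (cornerSum Π ≈ cellSum)
       × (BDefined → cornerSum (λ r s → inv (B r s) * Π r s) ≈ Σ[ 1 ⋯ ℓλ ] x)
       × (CDefined → cornerSum (λ r s → inv (C r s) * Π r s) ≈ Σ[ 1 ⋯ part λs 1 ] y)
       × (BDefined → CDefined →
            cornerSum (λ r s → inv (B r s * C r s) * Π r s) ≈ 1#)
theorem3p1 F λs ip λs≢[] x y Π-def = identity-a , identity-b , identity-c , identity-d λs≢[]
  where open Induction.SixIdentities (Induction.six-identities F y λs x ip Π-def)
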